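{- Let $n,\ell,k\ge1$ be integers, $p\in(0,1)$, and let $\mathbf{i}=(i_1,\dots,i_k)\in\mathcal{K}'$. If $k$ is even, then $$\mathbf{E}\Big(\prod_{j=1}^k Y_{i_j}\Big)=(p^{2\ell-1}-p^{2\ell})^{k/2};$$ if $k$ is odd, then $$\Big|\mathbf{E}\Big(\prod_{j=1}^k Y_{i_j}\Big)\Big|\le (p^{2\ell-1}-p^{2\ell})^{(k-3)/2}p^{3\ell-2}.$$
   Context: Let $\mathcal M=\{M_1,\dots,M_s\}$ be the set of all $\ell$-matchings (matchings with exactly $\ell$ edges) of the complete graph $K_{[n]}$, so $s=\binom{n}{2\ell}(2\ell-1)!!$. For $i\in[s]$, $X_i$ is the indicator that $M_i\subseteq\mathcal G(n,p)$ (the binomial random graph on $[n]$ with edge probability $p$), and $Y_i=X_i-p^\ell$. Let $H_{\mathcal M}$ be the graph on $\mathcal M$ in which $M\ne M'$ are adjacent iff $M\cap M'\neq\emptyset$. For $\mathbf i=(i_1,\dots,i_k)\in[s]^k$, $H_{\mathcal M}(\mathbf i)$ is the subgraph of $H_{\mathcal M}$ induced by $\{M_{i_1},\dots,M_{i_k}\}$ and $\mathcal C(\mathbf i)$ its set of components; for $C\in\mathcal C(\mathbf i)$, $\tilde n_C=|\{j: M_{i_j}\in V(C)\}|$ (number of matchings of $C$ counted with repetition). Two matchings form a kissing pair if they share exactly one edge. An ordered triple $(M_1,M_2,M_3)$ is a chained triple if $|M_1\cap M_2|=1$, $|M_2\cap M_3|=1$, $|M_1\cap M_3|=0$. A set of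 $t$ matchings is a flower with $t$ petals if there is an edge $e$ with $M\cap M'=\{e\}$ for all distinct $M,M'$ in the set. $\mathcal K$ is the set of $\mathbf i\in[s]^k$ such that every $C\in\mathcal C(\mathbf i)$ has $\tilde n_C\ge2$, and $\mathcal K'\subseteq\mathcal K$ is the set of $\mathbf i\in\mathcal K$ such that (a) $|\mathcal C(\mathbf i)|=\lfloor k/2\rfloor$; (b) every $C$ with $\tilde n_C=2$ is a kissing pair; (c) every $C$ with $\tilde n_C=3$ is (in some order) a chained triple or is a flower with 3 petals.
   Formalization: The edge probability $p$ ranges over the rationals in (0,1). -}

module Defs where

open import Data.Nat as ℕ using (ℕ; zero; suc; _∸_)
open import Data.Bool using (Bool; true; false; _∧_; _∨_; if_then_else_; not)
open import Data.Fin as Fin using (Fin; toℕ)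
open import Data.Fin.Properties using (_≟_)
open import Data.List using (List; []; _∷_; length; filter; map; foldr; _++_; allFin; concatMap)
open import Data.Bool.ListAction using (any; all)
open import Data.List.Relation.Unary.AllPairs using (AllPairs)
open import Data.List.Relation.Unary.All using (All)
open import Data.Product using (_×_; _,_; Σ; ∃)
open import Data.Sum using (_⊎_)
open import Data.Rational as ℚ using (ℚ; 0ℚ; 1ℚ; _+_; _*_; _-_)
open import Relation.Nullary using (¬_)
open import Relation.Nullary.Decidable using (⌊_⌋)
open import Relation.Binary.PropositionalEquality using (_≡_; _≢_)

_^ℚ_ : ℚ → ℕ → ℚ
x ^ℚ zero  = 1ℚ
x ^ℚ suc m = x * (x ^ℚ m)

-- Edges of K_[n]: pairs (a , b) with a < b; vertex set [n] = Fin n.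

Edge : ℕ → Set
Edge n = Fin n × Fin n

_==ᵉ_ : ∀ {n} → Edge n → Edge n → Bool
(a , b) ==ᵉ (c , d) = ⌊ a ≟ c ⌋ ∧ ⌊ b ≟ d ⌋

allEdges : (n : ℕ) → List (Edge n)
allEdges n = filter (λ e → Fin._<?_ (Data.Product.proj₁ e) (Data.Product.proj₂ e))
                    (concatMap (λ a → map (λ b → (a , b)) (allFin n)) (allFin n))
  where import Data.Product

_∈ᵇ_ : ∀ {n} → Edge n → List (Edge n) → Bool
e ∈ᵇ es = any (e ==ᵉ_) es

VDisjoint : ∀ {n} → Edge n → Edge n → Set
VDisjoint (a , b) (c , d) = a ≢ c × a ≢ d × b ≢ c × b ≢ d

-- An ℓ-matching: a list of ℓ edges of K_[n] (each (a,b) with a < b),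
-- pairwise vertex-disjoint.  (A matching is the SET of these edges;
-- every notion below only depends on this set.)
record Matching (n ℓ : ℕ) : Set where
  field
    edges    : List (Edge n)
    isEdge   : All (λ e → Data.Product.proj₁ e Fin.< Data.Product.proj₂ e) edges
    disjoint : AllPairs VDisjoint edges
    size     : length edges ≡ ℓ
open Matching public
import Data.Product

interSize : ∀ {n ℓ} → Matching n ℓ → Matching n ℓ → ℕ
interSize M M' = length (filter (λ e → Data.Bool.T? (e ∈ᵇ edges M')) (edges M))
  where import Data.Bool

SameMatching : ∀ {n ℓ} → Matching n ℓ → Matching n ℓ → Set
SameMatching M M' = All (λ e → e ∈ᵇ edges M' ≡ true) (edges M)
                  × All (λ e → e ∈ᵇ edges M ≡ true) (edges M')

Kissing : ∀ {n ℓ} → Matching n ℓ → Matching n ℓ → Set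
Kissing M M' = ¬ SameMatching M M' × interSize M M' ≡ 1

Chained : ∀ {n ℓ} → Matching n ℓ → Matching n ℓ → Matching n ℓ → Set
Chained M₁ M₂ M₃ = interSize M₁ M₂ ≡ 1 × interSize M₂ M₃ ≡ 1 × interSize M₁ M₃ ≡ 0

ChainedSomeOrder : ∀ {n ℓ} → Matching n ℓ → Matching n ℓ → Matching n ℓ → Set
ChainedSomeOrder A B C =
  Chained A B C ⊎ Chained A C B ⊎ Chained B A C ⊎
  Chained B C A ⊎ Chained C A B ⊎ Chained C B A

Flower3 : ∀ {n ℓ} → Matching n ℓ → Matching n ℓ → Matching n ℓ → Set
Flower3 {n} A B C =
  ¬ SameMatching A B × ¬ SameMatching A C × ¬ SameMatching B C ×
  Σ (Edge n) λ e → (e ∈ᵇ edges A ≡ true) × (e ∈ᵇ edges B ≡ true) × (e ∈ᵇ edges C ≡ true)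
                 × interSize A B ≡ 1 × interSize A C ≡ 1 × interSize B C ≡ 1

-- The graph H_M(i) on a tuple i = (M_{i_1},…,M_{i_k}) (given as a
-- function Fin k → Matching n ℓ), considered on the index set Fin k.
-- Indices j, j' are adjacent iff M_{i_j} ∩ M_{i_j'} ≠ ∅ (for ℓ ≥ 1 this
-- includes j, j' carrying the same matching, i.e. the same vertex of H_M).

module Tuple {n ℓ k : ℕ} (𝐢 : Fin k → Matching n ℓ) where

  adj : Fin k → Fin k → Bool
  adj j j' = any (λ e → e ∈ᵇ edges (𝐢 j')) (edges (𝐢 j))

  reach : ℕ → Fin k → Fin k → Bool
  reach zero    j j' = ⌊ j ≟ j' ⌋
  reach (suc t) j j' = reach t j j' ∨ any (λ m → reach t j m ∧ adj m j') (allFin k)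

  -- j and j' lie in the same component of H_M(i)  (walks of length ≤ k suffice)
  conn : Fin k → Fin k → Bool
  conn j j' = reach k j j'

  ñ : Fin k → ℕ
  ñ j = length (filter (λ m → Data.Bool.T? (conn j m)) (allFin k))
    where import Data.Bool

  -- |C(i)|: number of components = number of indices that are the least
  -- index of their component
  numComponents : ℕ
  numComponents =
    length (filter (λ j → Data.Bool.T? (not (any (λ m → ⌊ m Fin.<? j ⌋ ∧ conn m j) (allFin k))))
                   (allFin k))
    where import Data.Bool

InK : ∀ {n ℓ k} → (Fin k → Matching n ℓ) → Set
InK {k = k} 𝐢 = (j : Fin k) → 2 ℕ.≤ ñ j
  where open Tuple 𝐢

InK' : ∀ {n ℓ k} → (Fin k → Matching n ℓ) → Set
InK' {k = k} 𝐢 =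
  InK 𝐢
  × numComponents ≡ ℕ.⌊ k /2⌋
  × ((a b : Fin k) → a ≢ b → conn a b ≡ true → ñ a ≡ 2 → Kissing (𝐢 a) (𝐢 b))
  × ((a b c : Fin k) → a ≢ b → a ≢ c → b ≢ c → conn a b ≡ true → conn a c ≡ true → ñ a ≡ 3 →
       ChainedSomeOrder (𝐢 a) (𝐢 b) (𝐢 c) ⊎ Flower3 (𝐢 a) (𝐢 b) (𝐢 c))
  where open Tuple 𝐢

-- The binomial random graph G(n,p): a random subset S of the edges of
-- K_[n], each edge present independently with probability p.
-- E f = Σ_{S ⊆ E(K_n)} p^{|S|} (1-p)^{|E(K_n)|-|S|} f(S).

subsets : ∀ {A : Set} → List A → List (List A)
subsets []       = [] ∷ []
subsets (x ∷ xs) = let r = subsets xs in map (x ∷_) r ++ r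

weight : (n : ℕ) → ℚ → List (Edge n) → ℚ
weight n p S = (p ^ℚ length S) * ((1ℚ - p) ^ℚ (length (allEdges n) ∸ length S))

𝔼 : (n : ℕ) → ℚ → (List (Edge n) → ℚ) → ℚ
𝔼 n p f = sum′ (map (λ S → weight n p S * f S) (subsets (allEdges n)))
  where
  sum′ : List ℚ → ℚ
  sum′ = foldr _+_ 0ℚ

X : ∀ {n ℓ} → Matching n ℓ → List (Edge n) → ℚ
X M S = if all (_∈ᵇ S) (edges M) then 1ℚ else 0ℚ

Y : ∀ {n ℓ} → ℚ → Matching n ℓ → List (Edge n) → ℚ
Y {ℓ = ℓ} p M S = X M S - (p ^ℚ ℓ)

prodY : ∀ {n ℓ k} → ℚ → (Fin k → Matching n ℓ) → List (Edge n) → ℚ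
prodY {k = k} p 𝐢 S = foldr (λ j acc → Y p (𝐢 j) S * acc) 1ℚ (allFin k)

{-# OPTIONS --safe #-}
-- The random graph is a family of independent edge indicators, so functions of disjoint
-- sets of edges are independent. Matchings in different components of H_M(i) share no
-- edge, hence E ∏ Y_{i_j} factorises over the components. Every component has ñ_C ≥ 2 and
-- k = Σ_C ñ_C = 2|C(i)| + Σ_C (ñ_C - 2), so |C(i)| = ⌊k/2⌋ leaves only components of size 2
-- when k is even, and exactly one further component of size 3 when k is odd. A kissing pair
-- covers 2ℓ - 1 edges, so E(Y_M Y_M′) = p^(2ℓ-1) - p^(2ℓ). Chained triples and 3-flowers cover
-- 3ℓ - 2 edges, and inclusion-exclusion gives E(Y_M₁ Y_M₂ Y_M₃) = p^(3ℓ-2) (1-p)² resp.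
-- p^(3ℓ-2) (1-p)(1-2p), both of absolute value at most p^(3ℓ-2).
module Submission where

open import Defs
open import Data.Nat using (ℕ; zero; suc; _+_; _*_; _∸_; _≤_; z≤n; s≤s; ⌊_/2⌋)
import Data.Nat as ℕ
import Data.Nat.Properties as ℕₚ
open import Data.Rational as ℚ using (ℚ; 0ℚ; 1ℚ; _-_; -_; ∣_∣; _<_)
import Data.Rational
import Data.Rational.Properties as ℚₚ
open import Data.Rational.Solver using (module +-*-Solver)
import Data.Nat.Solver as ℕ-Solver
open import Data.Bool using (Bool; true; false; _∧_; _∨_; not; if_then_else_; T)
import Data.Bool.Properties as Boolₚ
open import Data.Bool.ListAction using (all; any)
open import Data.List using (List; []; _∷_; _++_; filter; length; foldr; map; allFin; concatMap; cartesianProduct)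
import Data.List.Properties as Listₚ
open import Data.List.Membership.Propositional using (_∈_; _∉_)
open import Data.List.Relation.Binary.Subset.Propositional using (_⊆_)
open import Data.List.Membership.Propositional.Properties
  using (∈-allFin; ∈-filter⁺; ∈-filter⁻; ∈-cartesianProduct⁺; ∈-++⁻)
open import Data.List.Relation.Unary.Any using (here; there)
open import Data.List.Relation.Unary.All using (All; []; _∷_)
import Data.List.Relation.Unary.All as All
open import Data.List.Relation.Unary.AllPairs using (_∷_)
import Data.List.Relation.Unary.AllPairs as AllPairs
open import Data.List.Relation.Unary.Unique.Propositional using (Unique)
open import Data.List.Relation.Unary.Unique.Propositional.Properties using (allFin⁺; filter⁺; cartesianProduct⁺)
open import Data.Fin using (Fin; toℕ)
import Data.Fin as Fin
import Data.Fin.Properties as Finₚ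
open import Data.Product using (Σ; _,_; proj₁; proj₂; _×_)
open import Data.Sum using (_⊎_; inj₁; inj₂)
open import Data.Empty using (⊥; ⊥-elim)
open import Relation.Nullary using (yes; no)
open import Relation.Nullary.Decidable using (T?; ⌊_⌋)
open import Relation.Binary.Definitions using (tri<; tri≈; tri>)
open import Relation.Binary.PropositionalEquality
open import Algebra.Properties.CommutativeSemigroup ℕₚ.+-commutativeSemigroup
  using () renaming (interchange to +-interchange)

true≢false : true ≢ false
true≢false ()

not-true : ∀ {b} → not b ≡ true → b ≡ false
not-true {false} _ = refl

not-false : ∀ {b} → not b ≡ false → b ≡ true
not-false {true} _ = refl

∨-true : ∀ {a b} → a ∨ b ≡ true → a ≡ true ⊎ b ≡ true
∨-true {true}  _ = inj₁ refl
∨-true {false} h = inj₂ h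

∧-true : ∀ {a b} → a ≡ true → b ≡ true → a ∧ b ≡ true
∧-true refl refl = refl

T⇒≡true : ∀ {b} → T b → b ≡ true
T⇒≡true {true} _ = refl

≡-by-implications : ∀ {x y : Bool} → (x ≡ true → y ≡ true) → (y ≡ true → x ≡ true) → x ≡ y
≡-by-implications {true}  {true}  _ _ = refl
≡-by-implications {true}  {false} f _ = sym (f refl)
≡-by-implications {false} {true}  _ g = g refl
≡-by-implications {false} {false} _ _ = refl

module _ {A : Set} where

  any-sound : (f : A → Bool) (xs : List A) → any f xs ≡ true → Σ A λ x → x ∈ xs × f x ≡ true
  any-sound f (x ∷ xs) h with f x in eq
  ... | true  = x , here refl , eq
  ... | false with any-sound f xs h
  ...   | y , y∈ , fy = y , there y∈ , fy

  any-complete : (f : A → Bool) (xs : List A) (x : A) → x ∈ xs → f x ≡ true → any f xs ≡ true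
  any-complete f (y ∷ xs) x (here refl) fx rewrite fx = refl
  any-complete f (y ∷ xs) x (there x∈) fx rewrite any-complete f xs x x∈ fx = Boolₚ.∨-zeroʳ (f y)

  any-cong : (f g : A → Bool) → (∀ x → f x ≡ g x) → (xs : List A) → any f xs ≡ any g xs
  any-cong f g h []       = refl
  any-cong f g h (x ∷ xs) = cong₂ _∨_ (h x) (any-cong f g h xs)

  any-++ : (f : A → Bool) (xs ys : List A) → any f (xs ++ ys) ≡ any f xs ∨ any f ys
  any-++ f []       ys = refl
  any-++ f (x ∷ xs) ys rewrite any-++ f xs ys = sym (Boolₚ.∨-assoc (f x) _ _)

  all-++ : (f : A → Bool) (xs ys : List A) → all f (xs ++ ys) ≡ all f xs ∧ all f ys
  all-++ f []       ys = refl
  all-++ f (x ∷ xs) ys rewrite all-++ f xs ys = sym (Boolₚ.∧-assoc (f x) _ _)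

  all-cong : (f g : A → Bool) (xs : List A) → (∀ x → x ∈ xs → f x ≡ g x) → all f xs ≡ all g xs
  all-cong f g []       h = refl
  all-cong f g (x ∷ xs) h = cong₂ _∧_ (h x (here refl)) (all-cong f g xs (λ y y∈ → h y (there y∈)))

  all-sound : (f : A → Bool) (xs : List A) → all f xs ≡ true → ∀ x → x ∈ xs → f x ≡ true
  all-sound f (y ∷ xs) h x (here refl) = Boolₚ.∧-conicalˡ (f y) _ h
  all-sound f (y ∷ xs) h x (there x∈) = all-sound f xs (Boolₚ.∧-conicalʳ (f y) _ h) x x∈

  unique-length-2 : (xs : List A) → Unique xs → length xs ≡ 2 →
                    Σ A λ x → Σ A λ y → x ≢ y × xs ≡ x ∷ y ∷ []
  unique-length-2 (x ∷ y ∷ []) ((x≢y ∷ []) ∷ _) _ = x , y , x≢y , refl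

  unique-length-3 : (xs : List A) → Unique xs → length xs ≡ 3 →
                    Σ A λ x → Σ A λ y → Σ A λ z → x ≢ y × x ≢ z × y ≢ z × xs ≡ x ∷ y ∷ z ∷ []
  unique-length-3 (x ∷ y ∷ z ∷ []) ((x≢y ∷ x≢z ∷ []) ∷ (y≢z ∷ []) ∷ _) _ =
    x , y , z , x≢y , x≢z , y≢z , refl

-- Sums and counts over lists

module _ {A : Set} where

  sumℕ : (A → ℕ) → List A → ℕ
  sumℕ f []       = 0
  sumℕ f (x ∷ xs) = f x + sumℕ f xs

  count : (A → Bool) → List A → ℕ
  count f = sumℕ (λ x → if f x then 1 else 0)

  sumℕ-cong : (f g : A → ℕ) (xs : List A) → (∀ x → x ∈ xs → f x ≡ g x) → sumℕ f xs ≡ sumℕ g xs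
  sumℕ-cong f g []       h = refl
  sumℕ-cong f g (x ∷ xs) h = cong₂ _+_ (h x (here refl)) (sumℕ-cong f g xs (λ y y∈ → h y (there y∈)))

  sumℕ-+ : (f g : A → ℕ) (xs : List A) → sumℕ (λ x → f x + g x) xs ≡ sumℕ f xs + sumℕ g xs
  sumℕ-+ f g []       = refl
  sumℕ-+ f g (x ∷ xs) rewrite sumℕ-+ f g xs = +-interchange (f x) (g x) (sumℕ f xs) (sumℕ g xs)

  sumℕ-*ˡ : (c : ℕ) (f : A → ℕ) (xs : List A) → sumℕ (λ x → c * f x) xs ≡ c * sumℕ f xs
  sumℕ-*ˡ c f []       = sym (ℕₚ.*-zeroʳ c)
  sumℕ-*ˡ c f (x ∷ xs) rewrite sumℕ-*ˡ c f xs = sym (ℕₚ.*-distribˡ-+ c (f x) _)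

  sumℕ-zero : (f : A → ℕ) (xs : List A) → (∀ x → x ∈ xs → f x ≡ 0) → sumℕ f xs ≡ 0
  sumℕ-zero f xs h = trans (sumℕ-cong f (λ _ → 0) xs h) (sumℕ-const-zero xs)
    where
    sumℕ-const-zero : (xs : List A) → sumℕ (λ _ → 0) xs ≡ 0
    sumℕ-const-zero []       = refl
    sumℕ-const-zero (_ ∷ xs) = sumℕ-const-zero xs

  sumℕ≡0⇒zero : (f : A → ℕ) (xs : List A) → sumℕ f xs ≡ 0 → ∀ x → x ∈ xs → f x ≡ 0
  sumℕ≡0⇒zero f (y ∷ xs) h x (here refl) = ℕₚ.m+n≡0⇒m≡0 (f y) h
  sumℕ≡0⇒zero f (y ∷ xs) h x (there x∈) = sumℕ≡0⇒zero f xs (ℕₚ.m+n≡0⇒n≡0 (f y) h) x x∈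

  sumℕ≡1⇒single : (f : A → ℕ) (xs : List A) → sumℕ f xs ≡ 1 →
    Σ A λ t → f t ≡ 1 × (∀ x → x ∈ xs → x ≢ t → f x ≡ 0)
  sumℕ≡1⇒single f (y ∷ xs) h with f y in eq
  ... | zero with sumℕ≡1⇒single f xs h
  ...   | t , ft , rest = t , ft , λ { x (here refl) _ → eq ; x (there x∈) x≢t → rest x x∈ x≢t }
  sumℕ≡1⇒single f (y ∷ xs) h | suc zero =
    y , eq , λ { x (here refl) x≢y → ⊥-elim (x≢y refl)
               ; x (there x∈) _ → sumℕ≡0⇒zero f xs (ℕₚ.suc-injective h) x x∈ }
  sumℕ≡1⇒single f (y ∷ xs) h | suc (suc _) with () ← ℕₚ.suc-injective h

  sumℕ-single : (f : A → ℕ) (xs : List A) (r : A) → Unique xs → r ∈ xs →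
                (∀ x → x ≢ r → f x ≡ 0) → sumℕ f xs ≡ f r
  sumℕ-single f (y ∷ xs) r (y∉xs ∷ _) (here refl) h =
    trans (cong (f y +_) (sumℕ-zero f xs (λ x x∈ → h x (λ x≡y → All.lookup y∉xs x∈ (sym x≡y)))))
          (ℕₚ.+-identityʳ (f y))
  sumℕ-single f (y ∷ xs) r (y∉xs ∷ uxs) (there r∈) h =
    trans (cong (_+ sumℕ f xs) (h y (All.lookup y∉xs r∈))) (sumℕ-single f xs r uxs r∈ h)

  sumℕ-one : (xs : List A) → sumℕ (λ _ → 1) xs ≡ length xs
  sumℕ-one []       = refl
  sumℕ-one (_ ∷ xs) = cong suc (sumℕ-one xs)

  length-filter≡count : (f : A → Bool) (xs : List A) → length (filter (λ x → T? (f x)) xs) ≡ count f xs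
  length-filter≡count f []       = refl
  length-filter≡count f (x ∷ xs) with f x
  ... | true  = cong suc (length-filter≡count f xs)
  ... | false = length-filter≡count f xs

  count-cong : (f g : A → Bool) (xs : List A) → (∀ x → x ∈ xs → f x ≡ g x) → count f xs ≡ count g xs
  count-cong f g xs h = sumℕ-cong _ _ xs (λ x x∈ → cong (λ b → if b then 1 else 0) (h x x∈))

  count-split : (f g : A → Bool) (xs : List A) →
                count f xs ≡ count (λ x → f x ∧ not (g x)) xs + count (λ x → f x ∧ g x) xs
  count-split f g xs = trans (sumℕ-cong _ _ xs (λ x _ → split (f x) (g x))) (sumℕ-+ _ _ xs)
    where
    split : ∀ a b → (if a then 1 else 0) ≡ (if a ∧ not b then 1 else 0) + (if a ∧ b then 1 else 0)
    split true  true  = refl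
    split true  false = refl
    split false _     = refl

  count-≤-length : (f : A → Bool) (xs : List A) → count f xs ≤ length xs
  count-≤-length f []       = z≤n
  count-≤-length f (x ∷ xs) with f x
  ... | true  = s≤s (count-≤-length f xs)
  ... | false = ℕₚ.m≤n⇒m≤1+n (count-≤-length f xs)

  count-mono : (f g : A → Bool) → (∀ x → f x ≡ true → g x ≡ true) → (xs : List A) →
               count f xs ≤ count g xs
  count-mono f g f⇒g []       = z≤n
  count-mono f g f⇒g (x ∷ xs) with f x in fx | g x in gx
  ... | true  | true  = s≤s (count-mono f g f⇒g xs)
  ... | true  | false = ⊥-elim (true≢false (trans (sym (f⇒g x fx)) gx))
  ... | false | true  = ℕₚ.m≤n⇒m≤1+n (count-mono f g f⇒g xs)
  ... | false | false = count-mono f g f⇒g xs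

  count-strict-mono : (f g : A → Bool) → (∀ x → f x ≡ true → g x ≡ true) → (xs : List A) →
                      (x : A) → x ∈ xs → f x ≡ false → g x ≡ true → count f xs ℕ.< count g xs
  count-strict-mono f g f⇒g (y ∷ xs) x (here refl) fx gx rewrite fx | gx = s≤s (count-mono f g f⇒g xs)
  count-strict-mono f g f⇒g (y ∷ xs) x (there x∈) fx gx with f y in fy | g y in gy
  ... | true  | true  = s≤s (count-strict-mono f g f⇒g xs x x∈ fx gx)
  ... | true  | false = ⊥-elim (true≢false (trans (sym (f⇒g y fy)) gy))
  ... | false | true  = ℕₚ.m≤n⇒m≤1+n (count-strict-mono f g f⇒g xs x x∈ fx gx)
  ... | false | false = count-strict-mono f g f⇒g xs x x∈ fx gx

  count-pos : (f : A → Bool) (xs : List A) (x : A) → x ∈ xs → f x ≡ true → 0 ℕ.< count f xs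
  count-pos f xs x x∈ fx =
    ℕₚ.≤-trans (s≤s z≤n) (count-strict-mono (λ _ → false) f (λ _ ()) xs x x∈ refl fx)

  count≡0⇒false : (f : A → Bool) (xs : List A) → count f xs ≡ 0 → ∀ x → x ∈ xs → f x ≡ false
  count≡0⇒false f xs h x x∈ with f x in fx
  ... | false = refl
  ... | true with () ← ℕₚ.<⇒≢ (count-pos f xs x x∈ fx) (sym h)

  count-pos⇒witness : (f : A → Bool) (xs : List A) → 0 ℕ.< count f xs → Σ A λ x → x ∈ xs × f x ≡ true
  count-pos⇒witness f (y ∷ xs) h with f y in fy
  ... | true  = y , here refl , fy
  ... | false with count-pos⇒witness f xs h
  ...   | x , x∈ , fx = x , there x∈ , fx

  ≡-or-witness : (f g : A → Bool) → (∀ x → f x ≡ true → g x ≡ true) → (xs : List A) →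
                 (∀ x → x ∈ xs → g x ≡ f x) ⊎ Σ A λ x → x ∈ xs × f x ≡ false × g x ≡ true
  ≡-or-witness f g f⇒g []       = inj₁ (λ _ ())
  ≡-or-witness f g f⇒g (y ∷ xs) with f y in fy | g y in gy | ≡-or-witness f g f⇒g xs
  ... | true  | false | _                 = ⊥-elim (true≢false (trans (sym (f⇒g y fy)) gy))
  ... | false | true  | _                 = inj₂ (y , here refl , fy , gy)
  ... | _     | _     | inj₂ (x , x∈ , r) = inj₂ (x , there x∈ , r)
  ... | true  | true  | inj₁ same = inj₁ λ { _ (here refl) → trans gy (sym fy) ; x (there x∈) → same x x∈ }
  ... | false | false | inj₁ same = inj₁ λ { _ (here refl) → trans gy (sym fy) ; x (there x∈) → same x x∈ }

  count≡1⇒unique : (f : A → Bool) (xs : List A) → count f xs ≡ 1 →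
                   ∀ x y → x ∈ xs → f x ≡ true → y ∈ xs → f y ≡ true → x ≡ y
  count≡1⇒unique f (z ∷ xs) h x y (here refl) fx (here refl) fy = refl
  count≡1⇒unique f (z ∷ xs) h x y (here refl) fx (there y∈) fy rewrite fx
    with () ← ℕₚ.<⇒≢ (count-pos f xs y y∈ fy) (sym (ℕₚ.suc-injective h))
  count≡1⇒unique f (z ∷ xs) h x y (there x∈) fx (here refl) fy rewrite fy
    with () ← ℕₚ.<⇒≢ (count-pos f xs x x∈ fx) (sym (ℕₚ.suc-injective h))
  count≡1⇒unique f (z ∷ xs) h x y (there x∈) fx (there y∈) fy with f z
  ... | true with () ← ℕₚ.<⇒≢ (count-pos f xs x x∈ fx) (sym (ℕₚ.suc-injective h))
  ... | false = count≡1⇒unique f xs h x y x∈ fx y∈ fy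

count-complement : {A : Set} (f : A → Bool) (xs : List A) →
                   count (λ x → not (f x)) xs ≡ length xs ∸ count f xs
count-complement f xs =
  sym (trans (cong (_∸ count f xs) (trans (sym (sumℕ-one xs)) (count-split (λ _ → true) f xs)))
             (ℕₚ.m+n∸n≡m _ (count f xs)))

sumℕ-swap : {A B : Set} (F : A → B → ℕ) (xs : List A) (ys : List B) →
            sumℕ (λ a → sumℕ (F a) ys) xs ≡ sumℕ (λ b → sumℕ (λ a → F a b) xs) ys
sumℕ-swap F []       ys = sym (sumℕ-zero _ ys (λ _ _ → refl))
sumℕ-swap F (x ∷ xs) ys rewrite sumℕ-swap F xs ys =
  sym (sumℕ-+ (F x) (λ b → sumℕ (λ a → F a b) xs) ys)

count-allFin-true : ∀ k → count (λ (_ : Fin k) → true) (allFin k) ≡ k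
count-allFin-true k = trans (sumℕ-one (allFin k)) (Listₚ.length-tabulate (λ x → x))

==ᵉ-refl : ∀ {n} (e : Edge n) → (e ==ᵉ e) ≡ true
==ᵉ-refl (a , b) with a Finₚ.≟ a | b Finₚ.≟ b
... | yes _  | yes _  = refl
... | no a≢a | _      = ⊥-elim (a≢a refl)
... | yes _  | no b≢b = ⊥-elim (b≢b refl)

==ᵉ-sound : ∀ {n} (e f : Edge n) → (e ==ᵉ f) ≡ true → e ≡ f
==ᵉ-sound (a , b) (c , d) eq with a Finₚ.≟ c | b Finₚ.≟ d
... | yes refl | yes refl = refl

==ᵉ-false : ∀ {n} (e f : Edge n) → e ≢ f → (e ==ᵉ f) ≡ false
==ᵉ-false e f e≢f with e ==ᵉ f in eq
... | true  = ⊥-elim (e≢f (==ᵉ-sound e f eq))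
... | false = refl

∈ᵇ-sound : ∀ {n} (e : Edge n) es → e ∈ᵇ es ≡ true → e ∈ es
∈ᵇ-sound e (x ∷ es) h with e ==ᵉ x in eq
... | true  = here (==ᵉ-sound e x eq)
... | false = there (∈ᵇ-sound e es h)

∈ᵇ-complete : ∀ {n} (e : Edge n) es → e ∈ es → e ∈ᵇ es ≡ true
∈ᵇ-complete e es e∈ = any-complete (e ==ᵉ_) es e e∈ (==ᵉ-refl e)

∈ᵇ-false : ∀ {n} (e : Edge n) es → e ∉ es → e ∈ᵇ es ≡ false
∈ᵇ-false e es e∉ with e ∈ᵇ es in eq
... | true  = ⊥-elim (e∉ (∈ᵇ-sound e es eq))
... | false = refl

concatMap-pairs≡cartesianProduct : ∀ {A B : Set} (xs : List A) (ys : List B) →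
  concatMap (λ a → map (a ,_) ys) xs ≡ cartesianProduct xs ys
concatMap-pairs≡cartesianProduct []       ys = refl
concatMap-pairs≡cartesianProduct (x ∷ xs) ys = cong (map (x ,_) ys ++_) (concatMap-pairs≡cartesianProduct xs ys)

allEdges-unique : ∀ n → Unique (allEdges n)
allEdges-unique n =
  filter⁺ _ (subst Unique (sym (concatMap-pairs≡cartesianProduct (allFin n) (allFin n)))
                           (cartesianProduct⁺ (allFin⁺ n) (allFin⁺ n)))

∈-allEdges : ∀ {n} {a b : Fin n} → a Fin.< b → (a , b) ∈ allEdges n
∈-allEdges {n} {a} {b} a<b =
  ∈-filter⁺ _ (subst ((a , b) ∈_) (sym (concatMap-pairs≡cartesianProduct (allFin n) (allFin n)))
                                 (∈-cartesianProduct⁺ (∈-allFin a) (∈-allFin b))) a<b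

++-⊆ : {A : Set} {xs ys zs : List A} → xs ⊆ zs → ys ⊆ zs → xs ++ ys ⊆ zs
++-⊆ {xs = xs} xs⊆zs ys⊆zs e∈ with ∈-++⁻ xs e∈
... | inj₁ e∈xs = xs⊆zs e∈xs
... | inj₂ e∈ys = ys⊆zs e∈ys

module _ {n ℓ : ℕ} (M : Matching n ℓ) where

  matching-unique : Unique (edges M)
  matching-unique = AllPairs.map (λ disj e≡f → proj₁ disj (cong proj₁ e≡f)) (disjoint M)

  matching⊆allEdges : edges M ⊆ allEdges n
  matching⊆allEdges e∈ = ∈-allEdges (All.lookup (isEdge M) e∈)

#distinct : ∀ {n} → List (Edge n) → ℕ
#distinct []      = 0
#distinct (x ∷ L) = if x ∈ᵇ L then #distinct L else suc (#distinct L)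

#distinct-unique : ∀ {n} (A : List (Edge n)) → Unique A → #distinct A ≡ length A
#distinct-unique []      _           = refl
#distinct-unique (a ∷ A) (a∉A ∷ uA) rewrite ∈ᵇ-false a A (λ a∈A → All.lookup a∉A a∈A refl) =
  cong suc (#distinct-unique A uA)

#shared : ∀ {n} → List (Edge n) → List (Edge n) → ℕ
#shared A B = count (_∈ᵇ B) A

#distinct-++ : ∀ {n} (A B : List (Edge n)) → Unique A →
               #distinct (A ++ B) ≡ (length A ∸ #shared A B) + #distinct B
#distinct-++ A B uA = trans (go A uA) (cong (_+ #distinct B) (count-complement (_∈ᵇ B) A))
  where
  go : ∀ A → Unique A → #distinct (A ++ B) ≡ count (λ x → not (x ∈ᵇ B)) A + #distinct B
  go []      _           = refl
  go (a ∷ A) (a∉A ∷ uA) rewrite any-++ (a ==ᵉ_) A B | ∈ᵇ-false a A (λ a∈A → All.lookup a∉A a∈A refl)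
    with a ∈ᵇ B
  ... | true  = go A uA
  ... | false = cong suc (go A uA)

infix 6 _∪ᴹ_

_∪ᴹ_ : ∀ {n ℓ} → Matching n ℓ → Matching n ℓ → List (Edge n)
M ∪ᴹ M′ = edges M ++ edges M′

∪ᴹ⊆allEdges : ∀ {n ℓ} (M M′ : Matching n ℓ) → M ∪ᴹ M′ ⊆ allEdges n
∪ᴹ⊆allEdges M M′ = ++-⊆ (matching⊆allEdges M) (matching⊆allEdges M′)

module _ {n ℓ : ℕ} where

  interSize≡#shared : (M M′ : Matching n ℓ) → interSize M M′ ≡ #shared (edges M) (edges M′)
  interSize≡#shared M M′ = length-filter≡count (_∈ᵇ edges M′) (edges M)

  #distinct-matching : (M : Matching n ℓ) → #distinct (edges M) ≡ ℓ
  #distinct-matching M = trans (#distinct-unique (edges M) (matching-unique M)) (size M)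

  #distinct-matching-++ : (M : Matching n ℓ) (B : List (Edge n)) →
                          #distinct (edges M ++ B) ≡ (ℓ ∸ #shared (edges M) B) + #distinct B
  #distinct-matching-++ M B =
    trans (#distinct-++ (edges M) B (matching-unique M))
          (cong (λ m → (m ∸ #shared (edges M) B) + #distinct B) (size M))

  #distinct-pair : (M M′ : Matching n ℓ) → #distinct (M ∪ᴹ M′) ≡ (ℓ ∸ interSize M M′) + ℓ
  #distinct-pair M M′ =
    trans (#distinct-matching-++ M (edges M′))
          (cong₂ (λ i d → (ℓ ∸ i) + d) (sym (interSize≡#shared M M′)) (#distinct-matching M′))

  #distinct-triple : (M₁ M₂ M₃ : Matching n ℓ) →
    #distinct (edges M₁ ++ (M₂ ∪ᴹ M₃))
      ≡ (ℓ ∸ #shared (edges M₁) (M₂ ∪ᴹ M₃)) + ((ℓ ∸ interSize M₂ M₃) + ℓ)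
  #distinct-triple M₁ M₂ M₃ =
    trans (#distinct-matching-++ M₁ _)
          (cong ((ℓ ∸ #shared (edges M₁) (M₂ ∪ᴹ M₃)) +_) (#distinct-pair M₂ M₃))

  #shared-chained : (M₁ M₂ M₃ : Matching n ℓ) → interSize M₁ M₂ ≡ 1 → interSize M₁ M₃ ≡ 0 →
                    #shared (edges M₁) (M₂ ∪ᴹ M₃) ≡ 1
  #shared-chained M₁ M₂ M₃ |M₁∩M₂|≡1 |M₁∩M₃|≡0 =
    trans (count-cong _ _ (edges M₁) only-M₂) (trans (sym (interSize≡#shared M₁ M₂)) |M₁∩M₂|≡1)
    where
    only-M₂ : ∀ x → x ∈ edges M₁ → x ∈ᵇ (M₂ ∪ᴹ M₃) ≡ x ∈ᵇ edges M₂
    only-M₂ x x∈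
      rewrite any-++ (x ==ᵉ_) (edges M₂) (edges M₃)
            | count≡0⇒false _ (edges M₁) (trans (sym (interSize≡#shared M₁ M₃)) |M₁∩M₃|≡0) x x∈ =
      Boolₚ.∨-identityʳ _

  #shared-flower : (M₁ M₂ M₃ : Matching n ℓ) (e : Edge n) →
                   e ∈ᵇ edges M₁ ≡ true → e ∈ᵇ edges M₂ ≡ true → e ∈ᵇ edges M₃ ≡ true →
                   interSize M₁ M₂ ≡ 1 → interSize M₁ M₃ ≡ 1 →
                   #shared (edges M₁) (M₂ ∪ᴹ M₃) ≡ 1
  #shared-flower M₁ M₂ M₃ e e∈M₁ e∈M₂ e∈M₃ |M₁∩M₂|≡1 |M₁∩M₃|≡1 =
    trans (count-cong _ _ (edges M₁) only-M₃) (trans (sym (interSize≡#shared M₁ M₃)) |M₁∩M₃|≡1)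
    where
    only-M₃ : ∀ x → x ∈ edges M₁ → x ∈ᵇ (M₂ ∪ᴹ M₃) ≡ x ∈ᵇ edges M₃
    only-M₃ x x∈ rewrite any-++ (x ==ᵉ_) (edges M₂) (edges M₃) with x ∈ᵇ edges M₂ in x∈M₂
    ... | false = refl
    ... | true rewrite count≡1⇒unique _ (edges M₁) (trans (sym (interSize≡#shared M₁ M₂)) |M₁∩M₂|≡1)
                         x e x∈ x∈M₂ (∈ᵇ-sound e _ e∈M₁) e∈M₂ = sym e∈M₃

-- Expectations in G(n,p)

sumℚ : List ℚ → ℚ
sumℚ = foldr ℚ._+_ 0ℚ

module _ {A : Set} where

  sumℚ-++ : (F : A → ℚ) (xs ys : List A) →
            sumℚ (map F (xs ++ ys)) ≡ sumℚ (map F xs) ℚ.+ sumℚ (map F ys)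
  sumℚ-++ F []       ys = sym (ℚₚ.+-identityˡ _)
  sumℚ-++ F (x ∷ xs) ys rewrite sumℚ-++ F xs ys = sym (ℚₚ.+-assoc (F x) _ _)

  sumℚ-cong : (F G : A → ℚ) → (∀ x → F x ≡ G x) → (xs : List A) → sumℚ (map F xs) ≡ sumℚ (map G xs)
  sumℚ-cong F G F≗G xs = cong sumℚ (Listₚ.map-cong F≗G xs)

  sumℚ-*ˡ : (c : ℚ) (F : A → ℚ) (xs : List A) →
            sumℚ (map (λ x → c ℚ.* F x) xs) ≡ c ℚ.* sumℚ (map F xs)
  sumℚ-*ˡ c F []       = sym (ℚₚ.*-zeroʳ c)
  sumℚ-*ˡ c F (x ∷ xs) rewrite sumℚ-*ˡ c F xs = sym (ℚₚ.*-distribˡ-+ c (F x) _)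

module RandomGraph (n : ℕ) (p : ℚ) where
  open +-*-Solver

  Graph : Set
  Graph = Edge n → Bool

  insert : Edge n → Graph → Graph
  insert x σ e = (e ==ᵉ x) ∨ σ e

  -- The expectation of G when the edges of L are present independently
  -- with probability p and no other edge is present.
  𝔼ᴸ : List (Edge n) → (Graph → ℚ) → ℚ
  𝔼ᴸ []      G = G (λ _ → false)
  𝔼ᴸ (x ∷ L) G = p ℚ.* 𝔼ᴸ L (λ σ → G (insert x σ)) ℚ.+ (1ℚ - p) ℚ.* 𝔼ᴸ L G

  graphOf : List (Edge n) → Graph
  graphOf S e = e ∈ᵇ S

  𝔼ᴳ : (Graph → ℚ) → ℚ
  𝔼ᴳ = 𝔼ᴸ (allEdges n)

  𝔼ᴸ-cong : ∀ L (G H : Graph → ℚ) → (∀ σ → G σ ≡ H σ) → 𝔼ᴸ L G ≡ 𝔼ᴸ L H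
  𝔼ᴸ-cong []      G H G≗H = G≗H _
  𝔼ᴸ-cong (x ∷ L) G H G≗H =
    cong₂ (λ a b → p ℚ.* a ℚ.+ (1ℚ - p) ℚ.* b)
          (𝔼ᴸ-cong L _ _ (λ σ → G≗H (insert x σ))) (𝔼ᴸ-cong L G H G≗H)

  -- The same expectation, for functions of the random sublist of L.
  𝔼ˢ : List (Edge n) → (List (Edge n) → ℚ) → ℚ
  𝔼ˢ []      f = f []
  𝔼ˢ (x ∷ L) f = p ℚ.* 𝔼ˢ L (λ S → f (x ∷ S)) ℚ.+ (1ℚ - p) ℚ.* 𝔼ˢ L f

  𝔼ˢ-graphOf : ∀ L (G : Graph → ℚ) → 𝔼ˢ L (λ S → G (graphOf S)) ≡ 𝔼ᴸ L G
  𝔼ˢ-graphOf []      G = refl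
  𝔼ˢ-graphOf (x ∷ L) G =
    cong₂ (λ a b → p ℚ.* a ℚ.+ (1ℚ - p) ℚ.* b)
          (𝔼ˢ-graphOf L (λ σ → G (insert x σ))) (𝔼ˢ-graphOf L G)

  weightIn : ℕ → List (Edge n) → ℚ
  weightIn N S = (p ^ℚ length S) ℚ.* ((1ℚ - p) ^ℚ (N ∸ length S))

  -- d counts the edges outside L, all of them absent.
  weighted-sum-subsets : ∀ L d (f : List (Edge n) → ℚ) →
    sumℚ (map (λ S → weightIn (d + length L) S ℚ.* f S) (subsets L)) ≡ ((1ℚ - p) ^ℚ d) ℚ.* 𝔼ˢ L f
  weighted-sum-subsets [] d f rewrite ℕₚ.+-identityʳ d =
    solve 2 (λ a b → (con 1ℚ :* a) :* b :+ con 0ℚ := a :* b) refl ((1ℚ - p) ^ℚ d) (f [])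
  weighted-sum-subsets (x ∷ L) d f =
    begin
      sumℚ (map F (map (x ∷_) (subsets L) ++ subsets L))
    ≡⟨ sumℚ-++ F (map (x ∷_) (subsets L)) (subsets L) ⟩
      sumℚ (map F (map (x ∷_) (subsets L))) ℚ.+ sumℚ (map F (subsets L))
    ≡⟨ cong (ℚ._+ sumℚ (map F (subsets L))) (cong sumℚ (sym (Listₚ.map-∘ (subsets L)))) ⟩
      sumℚ (map (λ S → F (x ∷ S)) (subsets L)) ℚ.+ sumℚ (map F (subsets L))
    ≡⟨ cong₂ ℚ._+_ (sumℚ-cong _ _ with-x (subsets L)) (sumℚ-cong _ _ without-x (subsets L)) ⟩
      sumℚ (map (λ S → p ℚ.* (weightIn (d + length L) S ℚ.* f (x ∷ S))) (subsets L))
        ℚ.+ sumℚ (map (λ S → weightIn (suc d + length L) S ℚ.* f S) (subsets L))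
    ≡⟨ cong (ℚ._+ _) (sumℚ-*ˡ p _ (subsets L)) ⟩
      p ℚ.* sumℚ (map (λ S → weightIn (d + length L) S ℚ.* f (x ∷ S)) (subsets L))
        ℚ.+ sumℚ (map (λ S → weightIn (suc d + length L) S ℚ.* f S) (subsets L))
    ≡⟨ cong₂ ℚ._+_ (cong (p ℚ.*_) (weighted-sum-subsets L d (λ S → f (x ∷ S))))
                   (weighted-sum-subsets L (suc d) f) ⟩
      p ℚ.* (((1ℚ - p) ^ℚ d) ℚ.* 𝔼ˢ L (λ S → f (x ∷ S)))
        ℚ.+ ((1ℚ - p) ℚ.* ((1ℚ - p) ^ℚ d)) ℚ.* 𝔼ˢ L f
    ≡⟨ solve 4 (λ p q a b → p :* (q :* a) :+ ((con 1ℚ :- p) :* q) :* b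
                         := q :* (p :* a :+ (con 1ℚ :- p) :* b))
               refl p ((1ℚ - p) ^ℚ d) (𝔼ˢ L (λ S → f (x ∷ S))) (𝔼ˢ L f) ⟩
      ((1ℚ - p) ^ℚ d) ℚ.* 𝔼ˢ (x ∷ L) f
    ∎
    where
    open ≡-Reasoning
    F : List (Edge n) → ℚ
    F S = weightIn (d + suc (length L)) S ℚ.* f S
    with-x : ∀ S → F (x ∷ S) ≡ p ℚ.* (weightIn (d + length L) S ℚ.* f (x ∷ S))
    with-x S rewrite ℕₚ.+-suc d (length L) =
      solve 4 (λ p a b c → (p :* a) :* b :* c := p :* (a :* b :* c)) refl p (p ^ℚ length S) _ (f (x ∷ S))
    without-x : ∀ S → F S ≡ weightIn (suc d + length L) S ℚ.* f S
    without-x S rewrite ℕₚ.+-suc d (length L) = refl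

  𝔼≡𝔼ᴳ : ∀ (G : Graph → ℚ) → 𝔼 n p (λ S → G (graphOf S)) ≡ 𝔼ᴳ G
  𝔼≡𝔼ᴳ G = trans (weighted-sum-subsets (allEdges n) 0 (λ S → G (graphOf S)))
                 (trans (ℚₚ.*-identityˡ _) (𝔼ˢ-graphOf (allEdges n) G))

  𝔼ᴸ-const : ∀ L c → 𝔼ᴸ L (λ _ → c) ≡ c
  𝔼ᴸ-const []      c = refl
  𝔼ᴸ-const (x ∷ L) c rewrite 𝔼ᴸ-const L c =
    solve 2 (λ p c → p :* c :+ (con 1ℚ :- p) :* c := c) refl p c

  𝔼ᴸ-+ : ∀ L (G H : Graph → ℚ) → 𝔼ᴸ L (λ σ → G σ ℚ.+ H σ) ≡ 𝔼ᴸ L G ℚ.+ 𝔼ᴸ L H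
  𝔼ᴸ-+ []      G H = refl
  𝔼ᴸ-+ (x ∷ L) G H rewrite 𝔼ᴸ-+ L (λ σ → G (insert x σ)) (λ σ → H (insert x σ)) | 𝔼ᴸ-+ L G H =
    solve 5 (λ p a b c d → p :* (a :+ b) :+ (con 1ℚ :- p) :* (c :+ d)
                        := (p :* a :+ (con 1ℚ :- p) :* c) :+ (p :* b :+ (con 1ℚ :- p) :* d)) refl p _ _ _ _

  𝔼ᴸ-*ˡ : ∀ L c (G : Graph → ℚ) → 𝔼ᴸ L (λ σ → c ℚ.* G σ) ≡ c ℚ.* 𝔼ᴸ L G
  𝔼ᴸ-*ˡ []      c G = refl
  𝔼ᴸ-*ˡ (x ∷ L) c G rewrite 𝔼ᴸ-*ˡ L c (λ σ → G (insert x σ)) | 𝔼ᴸ-*ˡ L c G =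
    solve 4 (λ p c a b → p :* (c :* a) :+ (con 1ℚ :- p) :* (c :* b)
                      := c :* (p :* a :+ (con 1ℚ :- p) :* b)) refl p c _ _

  AgreeOn : (Edge n → Bool) → Graph → Graph → Set
  AgreeOn P σ τ = ∀ e → P e ≡ true → σ e ≡ τ e

  DependsOn : (Edge n → Bool) → (Graph → ℚ) → Set
  DependsOn P G = ∀ σ τ → AgreeOn P σ τ → G σ ≡ G τ

  dependsOn-insert : ∀ {P G} x → DependsOn P G → DependsOn P (λ σ → G (insert x σ))
  dependsOn-insert x G∣P σ τ σ≈τ = G∣P _ _ (λ e Pe → cong ((e ==ᵉ x) ∨_) (σ≈τ e Pe))

  insert-irrelevant : ∀ {P G} x → DependsOn P G → P x ≡ false → ∀ σ → G (insert x σ) ≡ G σ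
  insert-irrelevant {P} x G∣P Px σ = G∣P _ _ agree
    where
    agree : AgreeOn P (insert x σ) σ
    agree e Pe with e ==ᵉ x in e≡x
    ... | true  = ⊥-elim (true≢false (trans (sym Pe) (trans (cong P (==ᵉ-sound e x e≡x)) Px)))
    ... | false = refl

  𝔼ᴸ-*-independent : ∀ L (P Q : Edge n → Bool) (G H : Graph → ℚ) → DependsOn P G → DependsOn Q H →
                     (∀ x → P x ≡ true → Q x ≡ true → ⊥) →
                     𝔼ᴸ L (λ σ → G σ ℚ.* H σ) ≡ 𝔼ᴸ L G ℚ.* 𝔼ᴸ L H
  𝔼ᴸ-*-independent []      P Q G H G∣P H∣Q P#Q = refl
  𝔼ᴸ-*-independent (x ∷ L) P Q G H G∣P H∣Q P#Q with P x in Px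
  ... | false
    rewrite 𝔼ᴸ-*-independent L P Q _ _ (dependsOn-insert x G∣P) (dependsOn-insert x H∣Q) P#Q
          | 𝔼ᴸ-*-independent L P Q G H G∣P H∣Q P#Q
          | 𝔼ᴸ-cong L (λ σ → G (insert x σ)) G (insert-irrelevant x G∣P Px) =
    solve 4 (λ p g a b → p :* (g :* a) :+ (con 1ℚ :- p) :* (g :* b)
                      := (p :* g :+ (con 1ℚ :- p) :* g) :* (p :* a :+ (con 1ℚ :- p) :* b)) refl p _ _ _
  ... | true with Q x in Qx
  ...   | true  = ⊥-elim (P#Q x Px Qx)
  ...   | false
    rewrite 𝔼ᴸ-*-independent L P Q _ _ (dependsOn-insert x G∣P) (dependsOn-insert x H∣Q) P#Q
          | 𝔼ᴸ-*-independent L P Q G H G∣P H∣Q P#Q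
          | 𝔼ᴸ-cong L (λ σ → H (insert x σ)) H (insert-irrelevant x H∣Q Qx) =
    solve 4 (λ p h a b → p :* (a :* h) :+ (con 1ℚ :- p) :* (b :* h)
                      := (p :* a :+ (con 1ℚ :- p) :* b) :* (p :* h :+ (con 1ℚ :- p) :* h)) refl p _ _ _

  𝔼ᴸ-ignored : ∀ L (P : Edge n → Bool) (G : Graph → ℚ) → DependsOn P G →
               (∀ x → x ∈ L → P x ≡ false) → 𝔼ᴸ L G ≡ G (λ _ → false)
  𝔼ᴸ-ignored []      P G G∣P L#P = refl
  𝔼ᴸ-ignored (x ∷ L) P G G∣P L#P
    rewrite 𝔼ᴸ-cong L (λ σ → G (insert x σ)) G (insert-irrelevant x G∣P (L#P x (here refl)))
          | 𝔼ᴸ-ignored L P G G∣P (λ y y∈ → L#P y (there y∈)) =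
    solve 2 (λ p g → p :* g :+ (con 1ℚ :- p) :* g := g) refl p _

  𝟙 : Bool → ℚ
  𝟙 b = if b then 1ℚ else 0ℚ

  𝟙-∧ : ∀ a b → 𝟙 (a ∧ b) ≡ 𝟙 a ℚ.* 𝟙 b
  𝟙-∧ true  b = sym (ℚₚ.*-identityˡ (𝟙 b))
  𝟙-∧ false b = sym (ℚₚ.*-zeroˡ (𝟙 b))

  𝟙⊆ : List (Edge n) → Graph → ℚ
  𝟙⊆ A σ = 𝟙 (all σ A)

  𝟙⊆-++ : ∀ A B σ → 𝟙⊆ (A ++ B) σ ≡ 𝟙⊆ A σ ℚ.* 𝟙⊆ B σ
  𝟙⊆-++ A B σ rewrite all-++ σ A B = 𝟙-∧ (all σ A) (all σ B)

  𝟙⊆-dependsOn : ∀ A → DependsOn (_∈ᵇ A) (𝟙⊆ A)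
  𝟙⊆-dependsOn A σ τ σ≈τ = cong 𝟙 (all-cong σ τ A (λ e e∈ → σ≈τ e (∈ᵇ-complete e A e∈)))

  𝔼ᴸ-edge : ∀ L a → Unique L → a ∈ L → 𝔼ᴸ L (λ σ → 𝟙 (σ a)) ≡ p
  𝔼ᴸ-edge (x ∷ L) a (x∉L ∷ _) (here refl)
    rewrite 𝔼ᴸ-cong L (λ σ → 𝟙 (insert a σ a)) (λ _ → 1ℚ) (λ σ → cong (λ b → 𝟙 (b ∨ σ a)) (==ᵉ-refl a))
          | 𝔼ᴸ-const L 1ℚ
          | 𝔼ᴸ-ignored L (_==ᵉ a) (λ σ → 𝟙 (σ a)) (λ σ τ σ≈τ → cong 𝟙 (σ≈τ a (==ᵉ-refl a)))
              (λ y y∈ → ==ᵉ-false y a (λ y≡a → All.lookup x∉L y∈ (sym y≡a))) =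
    solve 1 (λ p → p :* con 1ℚ :+ (con 1ℚ :- p) :* con 0ℚ := p) refl p
  𝔼ᴸ-edge (x ∷ L) a (x∉L ∷ uL) (there a∈)
    rewrite 𝔼ᴸ-cong L (λ σ → 𝟙 (insert x σ a)) (λ σ → 𝟙 (σ a))
              (λ σ → cong (λ b → 𝟙 (b ∨ σ a)) (==ᵉ-false a x (λ a≡x → All.lookup x∉L a∈ (sym a≡x))))
          | 𝔼ᴸ-edge L a uL a∈ =
    solve 1 (λ p → p :* p :+ (con 1ℚ :- p) :* p := p) refl p

  𝔼ᴸ-𝟙⊆ : ∀ L A → Unique L → A ⊆ L → 𝔼ᴸ L (𝟙⊆ A) ≡ p ^ℚ #distinct A
  𝔼ᴸ-𝟙⊆ L []      uL A⊆L = 𝔼ᴸ-const L 1ℚ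
  𝔼ᴸ-𝟙⊆ L (a ∷ A) uL A⊆L with a ∈ᵇ A in a∈A
  ... | true  = trans (𝔼ᴸ-cong L _ _ repeated) (𝔼ᴸ-𝟙⊆ L A uL (λ b∈ → A⊆L (there b∈)))
    where
    repeated : ∀ σ → 𝟙⊆ (a ∷ A) σ ≡ 𝟙⊆ A σ
    repeated σ with all σ A in allA
    ... | true  rewrite all-sound σ A allA a (∈ᵇ-sound a A a∈A) = refl
    ... | false rewrite Boolₚ.∧-zeroʳ (σ a) = refl
  ... | false =
    begin
      𝔼ᴸ L (𝟙⊆ (a ∷ A))
    ≡⟨ 𝔼ᴸ-cong L _ _ (λ σ → 𝟙-∧ (σ a) (all σ A)) ⟩
      𝔼ᴸ L (λ σ → 𝟙 (σ a) ℚ.* 𝟙⊆ A σ)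
    ≡⟨ 𝔼ᴸ-*-independent L (_==ᵉ a) (_∈ᵇ A) (λ σ → 𝟙 (σ a)) (𝟙⊆ A)
                         (λ σ τ σ≈τ → cong 𝟙 (σ≈τ a (==ᵉ-refl a))) (𝟙⊆-dependsOn A) a-apart ⟩
      𝔼ᴸ L (λ σ → 𝟙 (σ a)) ℚ.* 𝔼ᴸ L (𝟙⊆ A)
    ≡⟨ cong₂ ℚ._*_ (𝔼ᴸ-edge L a uL (A⊆L (here refl))) (𝔼ᴸ-𝟙⊆ L A uL (λ b∈ → A⊆L (there b∈))) ⟩
      p ℚ.* (p ^ℚ #distinct A)
    ∎
    where
    open ≡-Reasoning
    a-apart : ∀ x → (x ==ᵉ a) ≡ true → x ∈ᵇ A ≡ true → ⊥
    a-apart x x≡a x∈A rewrite ==ᵉ-sound x a x≡a = true≢false (trans (sym x∈A) a∈A)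

  LinComb : Set
  LinComb = List (ℚ × (Graph → ℚ))

  ⟪_⟫ : LinComb → Graph → ℚ
  ⟪ []           ⟫ σ = 0ℚ
  ⟪ (w , F) ∷ ts ⟫ σ = w ℚ.* F σ ℚ.+ ⟪ ts ⟫ σ

  ⟪_⟫ᴱ : LinComb → ℚ
  ⟪ []           ⟫ᴱ = 0ℚ
  ⟪ (w , F) ∷ ts ⟫ᴱ = w ℚ.* 𝔼ᴳ F ℚ.+ ⟪ ts ⟫ᴱ

  𝔼-lincomb : ∀ ts → 𝔼ᴳ ⟪ ts ⟫ ≡ ⟪ ts ⟫ᴱ
  𝔼-lincomb []           = 𝔼ᴸ-const (allEdges n) 0ℚ
  𝔼-lincomb ((w , F) ∷ ts) =
    trans (𝔼ᴸ-+ (allEdges n) (λ σ → w ℚ.* F σ) ⟪ ts ⟫)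
          (cong₂ ℚ._+_ (𝔼ᴸ-*ˡ (allEdges n) w F) (𝔼-lincomb ts))

  𝔼-𝟙⊆ : ∀ A → A ⊆ allEdges n → 𝔼ᴳ (𝟙⊆ A) ≡ p ^ℚ #distinct A
  𝔼-𝟙⊆ A = 𝔼ᴸ-𝟙⊆ (allEdges n) A (allEdges-unique n)

  module _ {ℓ : ℕ} where

    Yᵍ : Matching n ℓ → Graph → ℚ
    Yᵍ M σ = 𝟙⊆ (edges M) σ - p ^ℚ ℓ

    𝔼-𝟙-matching : (M : Matching n ℓ) → 𝔼ᴳ (𝟙⊆ (edges M)) ≡ p ^ℚ ℓ
    𝔼-𝟙-matching M = trans (𝔼-𝟙⊆ (edges M) (matching⊆allEdges M)) (cong (p ^ℚ_) (#distinct-matching M))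

    pair-moment : (M M′ : Matching n ℓ) →
      𝔼ᴳ (λ σ → Yᵍ M σ ℚ.* Yᵍ M′ σ) ≡ p ^ℚ #distinct (M ∪ᴹ M′) - p ^ℚ ℓ ℚ.* p ^ℚ ℓ
    pair-moment M M′ =
      begin
        𝔼ᴳ (λ σ → Yᵍ M σ ℚ.* Yᵍ M′ σ)
      ≡⟨ 𝔼ᴸ-cong (allEdges n) _ _ expand ⟩
        𝔼ᴳ ⟪ terms ⟫
      ≡⟨ 𝔼-lincomb terms ⟩
        ⟪ terms ⟫ᴱ
      ≡⟨ evaluate ⟩
        p ^ℚ #distinct (M ∪ᴹ M′) - c ℚ.* c
      ∎
      where
      open ≡-Reasoning
      c : ℚ
      c = p ^ℚ ℓ
      terms : LinComb
      terms = (1ℚ , 𝟙⊆ (M ∪ᴹ M′)) ∷ (- c , 𝟙⊆ (edges M)) ∷ (- c , 𝟙⊆ (edges M′)) ∷ (c ℚ.* c , λ _ → 1ℚ) ∷ []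
      expand : ∀ σ → Yᵍ M σ ℚ.* Yᵍ M′ σ ≡ ⟪ terms ⟫ σ
      expand σ rewrite 𝟙⊆-++ (edges M) (edges M′) σ =
        solve 3 (λ a b c → (a :- c) :* (b :- c)
                        := con 1ℚ :* (a :* b) :+ ((:- c) :* a :+ ((:- c) :* b :+ ((c :* c) :* con 1ℚ :+ con 0ℚ))))
                refl (𝟙⊆ (edges M) σ) (𝟙⊆ (edges M′) σ) c
      evaluate : ⟪ terms ⟫ᴱ ≡ p ^ℚ #distinct (M ∪ᴹ M′) - c ℚ.* c
      evaluate rewrite 𝔼-𝟙⊆ (M ∪ᴹ M′) (∪ᴹ⊆allEdges M M′) | 𝔼-𝟙-matching M | 𝔼-𝟙-matching M′
                     | 𝔼ᴸ-const (allEdges n) 1ℚ =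
        solve 2 (λ P c → con 1ℚ :* P :+ ((:- c) :* c :+ ((:- c) :* c :+ ((c :* c) :* con 1ℚ :+ con 0ℚ)))
                      := P :- c :* c) refl (p ^ℚ #distinct (M ∪ᴹ M′)) c

    triple-moment : (M₁ M₂ M₃ : Matching n ℓ) →
      𝔼ᴳ (λ σ → Yᵍ M₁ σ ℚ.* (Yᵍ M₂ σ ℚ.* Yᵍ M₃ σ))
        ≡ p ^ℚ #distinct (edges M₁ ++ (M₂ ∪ᴹ M₃))
          - p ^ℚ ℓ ℚ.* (p ^ℚ #distinct (M₁ ∪ᴹ M₂) ℚ.+ p ^ℚ #distinct (M₁ ∪ᴹ M₃) ℚ.+ p ^ℚ #distinct (M₂ ∪ᴹ M₃))
          ℚ.+ (p ^ℚ ℓ ℚ.* (p ^ℚ ℓ ℚ.* p ^ℚ ℓ) ℚ.+ p ^ℚ ℓ ℚ.* (p ^ℚ ℓ ℚ.* p ^ℚ ℓ))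
    triple-moment M₁ M₂ M₃ =
      begin
        𝔼ᴳ (λ σ → Yᵍ M₁ σ ℚ.* (Yᵍ M₂ σ ℚ.* Yᵍ M₃ σ))
      ≡⟨ 𝔼ᴸ-cong (allEdges n) _ _ expand ⟩
        𝔼ᴳ ⟪ terms ⟫
      ≡⟨ 𝔼-lincomb terms ⟩
        ⟪ terms ⟫ᴱ
      ≡⟨ evaluate ⟩
        _
      ∎
      where
      open ≡-Reasoning
      A B C : List (Edge n)
      A = edges M₁
      B = edges M₂
      C = edges M₃
      c : ℚ
      c = p ^ℚ ℓ
      terms : LinComb
      terms = (1ℚ , 𝟙⊆ (A ++ (B ++ C)))
            ∷ (- c , 𝟙⊆ (A ++ B)) ∷ (- c , 𝟙⊆ (A ++ C)) ∷ (- c , 𝟙⊆ (B ++ C))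
            ∷ (c ℚ.* c , 𝟙⊆ A) ∷ (c ℚ.* c , 𝟙⊆ B) ∷ (c ℚ.* c , 𝟙⊆ C)
            ∷ (- (c ℚ.* (c ℚ.* c)) , λ _ → 1ℚ) ∷ []
      expand : ∀ σ → Yᵍ M₁ σ ℚ.* (Yᵍ M₂ σ ℚ.* Yᵍ M₃ σ) ≡ ⟪ terms ⟫ σ
      expand σ rewrite 𝟙⊆-++ A (B ++ C) σ | 𝟙⊆-++ B C σ | 𝟙⊆-++ A B σ | 𝟙⊆-++ A C σ =
        solve 4 (λ a b d c → (a :- c) :* ((b :- c) :* (d :- c))
                   := con 1ℚ :* (a :* (b :* d))
                      :+ ((:- c) :* (a :* b) :+ ((:- c) :* (a :* d) :+ ((:- c) :* (b :* d)
                      :+ ((c :* c) :* a :+ ((c :* c) :* b :+ ((c :* c) :* d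
                      :+ ((:- (c :* (c :* c))) :* con 1ℚ :+ con 0ℚ))))))))
                refl (𝟙⊆ A σ) (𝟙⊆ B σ) (𝟙⊆ C σ) c
      evaluate : ⟪ terms ⟫ᴱ
        ≡ p ^ℚ #distinct (A ++ (B ++ C))
          - c ℚ.* (p ^ℚ #distinct (A ++ B) ℚ.+ p ^ℚ #distinct (A ++ C) ℚ.+ p ^ℚ #distinct (B ++ C))
          ℚ.+ (c ℚ.* (c ℚ.* c) ℚ.+ c ℚ.* (c ℚ.* c))
      evaluate
        rewrite 𝔼-𝟙⊆ (A ++ (B ++ C)) (++-⊆ (matching⊆allEdges M₁) (∪ᴹ⊆allEdges M₂ M₃))
              | 𝔼-𝟙⊆ (A ++ B) (∪ᴹ⊆allEdges M₁ M₂) | 𝔼-𝟙⊆ (A ++ C) (∪ᴹ⊆allEdges M₁ M₃)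
              | 𝔼-𝟙⊆ (B ++ C) (∪ᴹ⊆allEdges M₂ M₃)
              | 𝔼-𝟙-matching M₁ | 𝔼-𝟙-matching M₂ | 𝔼-𝟙-matching M₃ | 𝔼ᴸ-const (allEdges n) 1ℚ =
        solve 5 (λ T X Y Z c → con 1ℚ :* T :+ ((:- c) :* X :+ ((:- c) :* Y :+ ((:- c) :* Z
                   :+ ((c :* c) :* c :+ ((c :* c) :* c :+ ((c :* c) :* c
                   :+ ((:- (c :* (c :* c))) :* con 1ℚ :+ con 0ℚ)))))))
                 := T :- c :* (X :+ Y :+ Z) :+ (c :* (c :* c) :+ c :* (c :* c)))
                refl (p ^ℚ #distinct (A ++ (B ++ C))) (p ^ℚ #distinct (A ++ B)) (p ^ℚ #distinct (A ++ C))
                     (p ^ℚ #distinct (B ++ C)) c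

-- Components of H_M(i)

module Components {n ℓ k : ℕ} (𝐢 : Fin k → Matching n ℓ) where
  open Tuple 𝐢

  adj-sym : ∀ a b → adj a b ≡ true → adj b a ≡ true
  adj-sym a b h with any-sound _ (edges (𝐢 a)) h
  ... | e , e∈a , e∈b = any-complete _ (edges (𝐢 b)) e (∈ᵇ-sound e _ e∈b) (∈ᵇ-complete e _ e∈a)

  reach-suc : ∀ t a b → reach t a b ≡ true → reach (suc t) a b ≡ true
  reach-suc t a b h rewrite h = refl

  reach-+ : ∀ d t a b → reach t a b ≡ true → reach (d + t) a b ≡ true
  reach-+ zero    t a b h = h
  reach-+ (suc d) t a b h = reach-suc (d + t) a b (reach-+ d t a b h)

  reach-refl : ∀ t a → reach t a a ≡ true
  reach-refl zero a with a Finₚ.≟ a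
  ... | yes _  = refl
  ... | no a≢a = ⊥-elim (a≢a refl)
  reach-refl (suc t) a = reach-suc t a a (reach-refl t a)

  reach-step : ∀ t a m b → reach t a m ≡ true → adj m b ≡ true → reach (suc t) a b ≡ true
  reach-step t a m b a⇝m m~b
    rewrite any-complete (λ m → reach t a m ∧ adj m b) (allFin k) m (∈-allFin m) (∧-true a⇝m m~b) =
    Boolₚ.∨-zeroʳ (reach t a b)

  reach-zero : ∀ a b → reach 0 a b ≡ true → a ≡ b
  reach-zero a b h with a Finₚ.≟ b
  ... | yes a≡b = a≡b

  reach-suc⁻ : ∀ t a b → reach (suc t) a b ≡ true →
               reach t a b ≡ true ⊎ Σ (Fin k) λ m → reach t a m ≡ true × adj m b ≡ true
  reach-suc⁻ t a b h with ∨-true {reach t a b} h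
  ... | inj₁ a⇝b   = inj₁ a⇝b
  ... | inj₂ a⇝·~b with any-sound _ (allFin k) a⇝·~b
  ...   | m , _ , h′ = inj₂ (m , Boolₚ.∧-conicalˡ (reach t a m) _ h′ , Boolₚ.∧-conicalʳ (reach t a m) _ h′)

  reach-trans : ∀ s t a b c → reach s a b ≡ true → reach t b c ≡ true → reach (t + s) a c ≡ true
  reach-trans s zero    a b c a⇝b b⇝c rewrite reach-zero b c b⇝c = a⇝b
  reach-trans s (suc t) a b c a⇝b b⇝c with reach-suc⁻ t b c b⇝c
  ... | inj₁ b⇝c′          = reach-suc (t + s) a c (reach-trans s t a b c a⇝b b⇝c′)
  ... | inj₂ (m , b⇝m , m~c) = reach-step (t + s) a m c (reach-trans s t a b m a⇝b b⇝m) m~c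

  reach-sym : ∀ t a b → reach t a b ≡ true → reach t b a ≡ true
  reach-sym zero    a b a⇝b rewrite reach-zero a b a⇝b = reach-refl 0 b
  reach-sym (suc t) a b a⇝b with reach-suc⁻ t a b a⇝b
  ... | inj₁ a⇝b′            = reach-suc t b a (reach-sym t a b a⇝b′)
  ... | inj₂ (m , a⇝m , m~b) =
    subst (λ s → reach s b a ≡ true) (ℕₚ.+-comm t 1)
      (reach-trans 1 t b m a (reach-step 0 b b m (reach-refl 0 b) (adj-sym m b m~b)) (reach-sym t a m a⇝m))

  Stable : ℕ → Fin k → Set
  Stable t a = ∀ b → reach (suc t) a b ≡ reach t a b

  stable-suc : ∀ t a → Stable t a → Stable (suc t) a
  stable-suc t a st b =
    begin
      reach (suc t) a b ∨ any (λ m → reach (suc t) a m ∧ adj m b) (allFin k)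
    ≡⟨ cong (reach (suc t) a b ∨_) (any-cong _ _ (λ m → cong (_∧ adj m b) (st m)) (allFin k)) ⟩
      (reach t a b ∨ step) ∨ step
    ≡⟨ Boolₚ.∨-assoc (reach t a b) step step ⟩
      reach t a b ∨ (step ∨ step)
    ≡⟨ cong (reach t a b ∨_) (Boolₚ.∨-idem step) ⟩
      reach (suc t) a b
    ∎
    where
    open ≡-Reasoning
    step : Bool
    step = any (λ m → reach t a m ∧ adj m b) (allFin k)

  reach-stable : ∀ u t a → Stable t a → ∀ b → reach (u + t) a b ≡ reach t a b
  reach-stable zero    t a st b = refl
  reach-stable (suc u) t a st b = trans (stable-+ u b) (reach-stable u t a st b)
    where
    stable-+ : ∀ u → Stable (u + t) a
    stable-+ zero    = st
    stable-+ (suc u) = stable-suc (u + t) a (stable-+ u)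

  #reach : ℕ → Fin k → ℕ
  #reach t a = count (reach t a) (allFin k)

  reach-grows-or-stable : ∀ a t → t ℕ.< #reach t a ⊎ Σ ℕ (λ t′ → t′ ≤ t × Stable t′ a)
  reach-grows-or-stable a zero = inj₁ (count-pos (reach 0 a) (allFin k) a (∈-allFin a) (reach-refl 0 a))
  reach-grows-or-stable a (suc t) with reach-grows-or-stable a t
  ... | inj₂ (t′ , t′≤t , st) = inj₂ (t′ , ℕₚ.m≤n⇒m≤1+n t′≤t , st)
  ... | inj₁ t<#reach with ≡-or-witness (reach t a) (reach (suc t) a) (reach-suc t a) (allFin k)
  ... | inj₁ same = inj₂ (t , ℕₚ.n≤1+n t , λ b → same b (∈-allFin b))
  ... | inj₂ (x , x∈ , old , new) =
    inj₁ (ℕₚ.≤-trans (s≤s t<#reach)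
            (count-strict-mono (reach t a) (reach (suc t) a) (reach-suc t a) (allFin k) x x∈ old new))

  -- Pigeonhole: the reachable set grows strictly until it is stable, and it has at most k elements.
  reach-stabilises : ∀ a → Σ ℕ λ t′ → t′ ≤ k × Stable t′ a
  reach-stabilises a with reach-grows-or-stable a k
  ... | inj₂ r = r
  ... | inj₁ k<#reach = ⊥-elim (ℕₚ.<-irrefl refl (ℕₚ.≤-trans k<#reach
           (subst (#reach k a ≤_) (Listₚ.length-tabulate (λ x → x)) (count-≤-length (reach k a) (allFin k)))))

  reach-beyond-k : ∀ u a b → reach (u + k) a b ≡ reach k a b
  reach-beyond-k u a b with reach-stabilises a
  ... | t′ , t′≤k , st =
    begin
      reach (u + k) a b
    ≡⟨ cong (λ s → reach s a b)
            (trans (cong (u +_) (sym (ℕₚ.m∸n+n≡m t′≤k))) (sym (ℕₚ.+-assoc u (k ∸ t′) t′))) ⟩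
      reach ((u + (k ∸ t′)) + t′) a b
    ≡⟨ reach-stable (u + (k ∸ t′)) t′ a st b ⟩
      reach t′ a b
    ≡⟨ sym (reach-stable (k ∸ t′) t′ a st b) ⟩
      reach ((k ∸ t′) + t′) a b
    ≡⟨ cong (λ s → reach s a b) (ℕₚ.m∸n+n≡m t′≤k) ⟩
      reach k a b
    ∎
    where open ≡-Reasoning

  conn-refl : ∀ a → conn a a ≡ true
  conn-refl = reach-refl k

  conn-sym : ∀ a b → conn a b ≡ true → conn b a ≡ true
  conn-sym = reach-sym k

  conn-trans : ∀ a b c → conn a b ≡ true → conn b c ≡ true → conn a c ≡ true
  conn-trans a b c a~b b~c = trans (sym (reach-beyond-k k a c)) (reach-trans k k a b c a~b b~c)

  adj⇒conn : ∀ a b → adj a b ≡ true → conn a b ≡ true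
  adj⇒conn a b a~b =
    subst (λ s → reach s a b ≡ true) (ℕₚ.m∸n+n≡m {k} {1} (ℕₚ.≤-trans (s≤s z≤n) (Finₚ.toℕ<n a)))
      (reach-+ (k ∸ 1) 1 a b (reach-step 0 a a b (reach-refl 0 a) a~b))

  conn-cong : ∀ a b → conn a b ≡ true → ∀ x → conn a x ≡ conn b x
  conn-cong a b a~b x = ≡-by-implications (conn-trans b a x (conn-sym a b a~b)) (conn-trans a b x a~b)

  ñ≡count : ∀ a → ñ a ≡ count (conn a) (allFin k)
  ñ≡count a = length-filter≡count (conn a) (allFin k)

  ñ-cong : ∀ a b → conn a b ≡ true → ñ a ≡ ñ b
  ñ-cong a b a~b =
    trans (ñ≡count a) (trans (count-cong _ _ (allFin k) (λ x _ → conn-cong a b a~b x)) (sym (ñ≡count b)))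

⌊2m/2⌋≡m : ∀ m → ⌊ 2 * m /2⌋ ≡ m
⌊2m/2⌋≡m m rewrite ℕₚ.+-identityʳ m = go m
  where
  go : ∀ m → ⌊ m + m /2⌋ ≡ m
  go zero    = refl
  go (suc m) rewrite ℕₚ.+-suc m m = cong suc (go m)

⌊2m+1/2⌋≡m : ∀ m → ⌊ 2 * m + 1 /2⌋ ≡ m
⌊2m+1/2⌋≡m m rewrite ℕₚ.+-identityʳ m | ℕₚ.+-comm (m + m) 1 = go m
  where
  go : ∀ m → ⌊ suc (m + m) /2⌋ ≡ m
  go zero    = refl
  go (suc m) rewrite ℕₚ.+-suc m m = cong suc (go m)

x+3≡2m+1⇒x≡2[m∸1] : ∀ m x → x + 3 ≡ 2 * m + 1 → x ≡ 2 * (m ∸ 1)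
x+3≡2m+1⇒x≡2[m∸1] zero    x h
  with () ← ℕₚ.m+n≡0⇒n≡0 x (ℕₚ.suc-injective (trans (sym (ℕₚ.+-suc x 2)) h))
x+3≡2m+1⇒x≡2[m∸1] (suc m) x h =
  ℕₚ.+-cancelʳ-≡ 3 x (2 * m)
    (trans h (solve 1 (λ m → con 2 :* (con 1 :+ m) :+ con 1 := con 2 :* m :+ con 3) refl m))
  where open ℕ-Solver.+-*-Solver

module ComponentCount {n ℓ k : ℕ} (𝐢 : Fin k → Matching n ℓ) where
  open Tuple 𝐢
  open Components 𝐢

  isLeast : Fin k → Bool
  isLeast j = not (any (λ m → ⌊ m Fin.<? j ⌋ ∧ conn m j) (allFin k))

  least-exists : ∀ m → Σ (Fin k) λ r → isLeast r ≡ true × conn r m ≡ true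
  least-exists m = go (suc (toℕ m)) m ℕₚ.≤-refl (conn-refl m)
    where
    go : (fuel : ℕ) (j : Fin k) → toℕ j ℕ.< fuel → conn j m ≡ true →
         Σ (Fin k) λ r → isLeast r ≡ true × conn r m ≡ true
    go (suc fuel) j j<fuel j~m with isLeast j in least
    ... | true  = j , least , j~m
    ... | false with any-sound _ (allFin k) (not-false least)
    ...   | j′ , _ , h =
      go fuel j′ (ℕₚ.<-≤-trans (lt (Boolₚ.∧-conicalˡ _ _ h)) (ℕₚ.≤-pred j<fuel))
         (conn-trans j′ j m (Boolₚ.∧-conicalʳ ⌊ j′ Fin.<? j ⌋ _ h) j~m)
      where
      lt : ⌊ j′ Fin.<? j ⌋ ≡ true → j′ Fin.< j
      lt h with j′ Fin.<? j
      ... | yes j′<j = j′<j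

  not-least : ∀ r r′ → r Fin.< r′ → conn r r′ ≡ true → isLeast r′ ≡ true → ⊥
  not-least r r′ r<r′ r~r′ least =
    true≢false (trans (sym least)
      (cong not (any-complete _ (allFin k) r (∈-allFin r) (∧-true (lt r<r′) r~r′))))
    where
    lt : r Fin.< r′ → ⌊ r Fin.<? r′ ⌋ ≡ true
    lt r<r′ with r Fin.<? r′
    ... | yes _    = refl
    ... | no r≮r′ = ⊥-elim (r≮r′ r<r′)

  least-unique : ∀ r r′ m → isLeast r ≡ true → isLeast r′ ≡ true →
                 conn r m ≡ true → conn r′ m ≡ true → r ≡ r′
  least-unique r r′ m least least′ r~m r′~m with Finₚ.<-cmp r r′
  ... | tri< r<r′ _ _ = ⊥-elim (not-least r r′ r<r′ (conn-trans r m r′ r~m (conn-sym r′ m r′~m)) least′)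
  ... | tri≈ _ r≡r′ _ = r≡r′
  ... | tri> _ _ r′<r = ⊥-elim (not-least r′ r r′<r (conn-trans r′ m r r′~m (conn-sym r m r~m)) least)

  sum-ñ : sumℕ (λ j → if isLeast j then ñ j else 0) (allFin k) ≡ k
  sum-ñ =
    begin
      sumℕ (λ j → if isLeast j then ñ j else 0) (allFin k)
    ≡⟨ sumℕ-cong _ _ (allFin k) (λ j _ → as-count j) ⟩
      sumℕ (λ j → sumℕ (λ m → 𝟙ℕ (isLeast j ∧ conn j m)) (allFin k)) (allFin k)
    ≡⟨ sumℕ-swap (λ j m → 𝟙ℕ (isLeast j ∧ conn j m)) (allFin k) (allFin k) ⟩
      sumℕ (λ m → sumℕ (λ j → 𝟙ℕ (isLeast j ∧ conn j m)) (allFin k)) (allFin k)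
    ≡⟨ sumℕ-cong _ _ (allFin k) (λ m _ → one-least m) ⟩
      count (λ _ → true) (allFin k)
    ≡⟨ count-allFin-true k ⟩
      k
    ∎
    where
    open ≡-Reasoning
    𝟙ℕ : Bool → ℕ
    𝟙ℕ b = if b then 1 else 0
    as-count : ∀ j → (if isLeast j then ñ j else 0) ≡ sumℕ (λ m → 𝟙ℕ (isLeast j ∧ conn j m)) (allFin k)
    as-count j with isLeast j
    ... | true  = ñ≡count j
    ... | false = sym (sumℕ-zero _ (allFin k) (λ _ _ → refl))
    one-least : ∀ m → sumℕ (λ j → 𝟙ℕ (isLeast j ∧ conn j m)) (allFin k) ≡ 1
    one-least m with least-exists m
    ... | r , least , r~m =
      trans (sumℕ-single _ (allFin k) r (allFin⁺ k) (∈-allFin r) others) (cong 𝟙ℕ (∧-true least r~m))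
      where
      others : ∀ x → x ≢ r → 𝟙ℕ (isLeast x ∧ conn x m) ≡ 0
      others x x≢r with isLeast x in least′ | conn x m in x~m
      ... | true  | true  = ⊥-elim (x≢r (least-unique x r m least′ least x~m r~m))
      ... | true  | false = refl
      ... | false | _     = refl

  module _ (inK : InK 𝐢) where

    excess : ℕ
    excess = sumℕ (λ j → if isLeast j then ñ j ∸ 2 else 0) (allFin k)

    k≡2c+excess : k ≡ 2 * numComponents + excess
    k≡2c+excess =
      begin
        k
      ≡⟨ sym sum-ñ ⟩
        sumℕ (λ j → if isLeast j then ñ j else 0) (allFin k)
      ≡⟨ sumℕ-cong _ _ (allFin k) (λ j _ → split j) ⟩
        sumℕ (λ j → 2 * (if isLeast j then 1 else 0) + (if isLeast j then ñ j ∸ 2 else 0)) (allFin k)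
      ≡⟨ sumℕ-+ _ _ (allFin k) ⟩
        sumℕ (λ j → 2 * (if isLeast j then 1 else 0)) (allFin k) + excess
      ≡⟨ cong (_+ excess) (trans (sumℕ-*ˡ 2 _ (allFin k))
                                 (cong (2 *_) (sym (length-filter≡count isLeast (allFin k))))) ⟩
        2 * numComponents + excess
      ∎
      where
      open ≡-Reasoning
      split : ∀ j → (if isLeast j then ñ j else 0)
                    ≡ 2 * (if isLeast j then 1 else 0) + (if isLeast j then ñ j ∸ 2 else 0)
      split j with isLeast j
      ... | true  = sym (ℕₚ.m+[n∸m]≡n (inK j))
      ... | false = refl

    ñ≡2-if-no-excess : ∀ r → isLeast r ≡ true → (if isLeast r then ñ r ∸ 2 else 0) ≡ 0 →
                       ∀ j → conn r j ≡ true → ñ j ≡ 2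
    ñ≡2-if-no-excess r least no-excess j r~j =
      trans (sym (ñ-cong r j r~j))
            (ℕₚ.≤-antisym (ℕₚ.m∸n≡0⇒m≤n (subst (λ b → (if b then ñ r ∸ 2 else 0) ≡ 0) least no-excess))
                          (inK r))

    even-components : numComponents ≡ ⌊ k /2⌋ → ∀ m → k ≡ 2 * m → ∀ j → ñ j ≡ 2
    even-components #C≡k/2 m k≡2m j with least-exists j
    ... | r , least , r~j =
      ñ≡2-if-no-excess r least (sumℕ≡0⇒zero _ (allFin k) excess≡0 r (∈-allFin r)) j r~j
      where
      excess≡0 : excess ≡ 0
      excess≡0 = ℕₚ.+-cancelˡ-≡ (2 * m) excess 0
        (sym (trans (ℕₚ.+-identityʳ (2 * m)) (trans (sym k≡2m) (trans k≡2c+excess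
          (cong (λ c → 2 * c + excess) (trans #C≡k/2 (trans (cong ⌊_/2⌋ k≡2m) (⌊2m/2⌋≡m m))))))))

    odd-components : numComponents ≡ ⌊ k /2⌋ → ∀ m → k ≡ 2 * m + 1 →
                     Σ (Fin k) λ t → ñ t ≡ 3 × (∀ j → conn t j ≡ false → ñ j ≡ 2)
    odd-components #C≡k/2 m k≡2m+1 with sumℕ≡1⇒single _ (allFin k) excess≡1
      where
      excess≡1 : excess ≡ 1
      excess≡1 = ℕₚ.+-cancelˡ-≡ (2 * m) excess 1
        (sym (trans (sym k≡2m+1) (trans k≡2c+excess
          (cong (λ c → 2 * c + excess) (trans #C≡k/2 (trans (cong ⌊_/2⌋ k≡2m+1) (⌊2m+1/2⌋≡m m)))))))
    ... | t , excess-t , no-other-excess = t , ñt≡3 , others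
      where
      least : isLeast t ≡ true
      least = if-nonzero (isLeast t) excess-t
        where
        if-nonzero : ∀ b {x} → (if b then x else 0) ≡ 1 → b ≡ true
        if-nonzero true _ = refl
      ñt≡3 : ñ t ≡ 3
      ñt≡3 = trans (sym (ℕₚ.m+[n∸m]≡n (inK t)))
                   (cong (2 +_) (subst (λ b → (if b then ñ t ∸ 2 else 0) ≡ 1) least excess-t))
      others : ∀ j → conn t j ≡ false → ñ j ≡ 2
      others j t≁j with least-exists j
      ... | r , least-r , r~j = ñ≡2-if-no-excess r least-r (no-other-excess r (∈-allFin r) r≢t) j r~j
        where
        r≢t : r ≢ t
        r≢t refl = true≢false (trans (sym r~j) t≁j)

-- Factorisation over the components

module Factorisation {n ℓ k : ℕ} (p : ℚ) (𝐢 : Fin k → Matching n ℓ) where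
  open RandomGraph n p
  open Tuple 𝐢
  open Components 𝐢
  open +-*-Solver

  Y′ : Fin k → Graph → ℚ
  Y′ j = Yᵍ (𝐢 j)

  ∏Y : (Fin k → Bool) → List (Fin k) → Graph → ℚ
  ∏Y sel L σ = foldr (λ j acc → (if sel j then Y′ j σ else 1ℚ) ℚ.* acc) 1ℚ L

  ∏Y-split : ∀ (sel g : Fin k → Bool) L σ →
             ∏Y sel L σ ≡ ∏Y (λ j → sel j ∧ not (g j)) L σ ℚ.* ∏Y (λ j → sel j ∧ g j) L σ
  ∏Y-split sel g []      σ = sym (ℚₚ.*-identityˡ 1ℚ)
  ∏Y-split sel g (x ∷ L) σ =
    trans (cong ((if sel x then Y′ x σ else 1ℚ) ℚ.*_) (∏Y-split sel g L σ))
          (factor (sel x) (g x) (Y′ x σ) _ _)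
    where
    open +-*-Solver
    factor : ∀ a b y o i → (if a then y else 1ℚ) ℚ.* (o ℚ.* i)
                         ≡ ((if a ∧ not b then y else 1ℚ) ℚ.* o) ℚ.* ((if a ∧ b then y else 1ℚ) ℚ.* i)
    factor true  true  y o i = solve 3 (λ y o i → y :* (o :* i) := (con 1ℚ :* o) :* (y :* i)) refl y o i
    factor true  false y o i = solve 3 (λ y o i → y :* (o :* i) := (y :* o) :* (con 1ℚ :* i)) refl y o i
    factor false _     y o i =
      solve 2 (λ o i → con 1ℚ :* (o :* i) := (con 1ℚ :* o) :* (con 1ℚ :* i)) refl o i

  ∏Y-filter : ∀ (sel : Fin k → Bool) L σ →
              ∏Y sel L σ ≡ foldr (λ j acc → Y′ j σ ℚ.* acc) 1ℚ (filter (λ j → T? (sel j)) L)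
  ∏Y-filter sel []      σ = refl
  ∏Y-filter sel (x ∷ L) σ with sel x
  ... | true  = cong (Y′ x σ ℚ.*_) (∏Y-filter sel L σ)
  ... | false = trans (ℚₚ.*-identityˡ _) (∏Y-filter sel L σ)

  ∏Y-cong : ∀ (sel sel′ : Fin k → Bool) → (∀ j → sel j ≡ sel′ j) → ∀ L σ → ∏Y sel L σ ≡ ∏Y sel′ L σ
  ∏Y-cong sel sel′ same []      σ = refl
  ∏Y-cong sel sel′ same (x ∷ L) σ =
    cong₂ ℚ._*_ (cong (λ b → if b then Y′ x σ else 1ℚ) (same x)) (∏Y-cong sel sel′ same L σ)

  ∏Y-empty : ∀ (sel : Fin k → Bool) L σ → (∀ j → j ∈ L → sel j ≡ false) → ∏Y sel L σ ≡ 1ℚ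
  ∏Y-empty sel []      σ _    = refl
  ∏Y-empty sel (x ∷ L) σ none rewrite none x (here refl) =
    trans (ℚₚ.*-identityˡ _) (∏Y-empty sel L σ (λ j j∈ → none j (there j∈)))

  edgesOf : (Fin k → Bool) → Edge n → Bool
  edgesOf sel x = any (λ j → sel j ∧ (x ∈ᵇ edges (𝐢 j))) (allFin k)

  ∏Y-dependsOn : ∀ (sel : Fin k → Bool) → DependsOn (edgesOf sel) (∏Y sel (allFin k))
  ∏Y-dependsOn sel σ τ σ≈τ = go (allFin k)
    where
    factor : ∀ j → (if sel j then Y′ j σ else 1ℚ) ≡ (if sel j then Y′ j τ else 1ℚ)
    factor j with sel j in selj
    ... | false = refl
    ... | true  = cong (_- p ^ℚ ℓ) (𝟙⊆-dependsOn (edges (𝐢 j)) σ τ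
                    (λ e e∈ → σ≈τ e (any-complete _ (allFin k) j (∈-allFin j) (∧-true selj e∈))))
    go : ∀ L → ∏Y sel L σ ≡ ∏Y sel L τ
    go []      = refl
    go (x ∷ L) = cong₂ ℚ._*_ (factor x) (go L)

  -- g is a union of components, and matchings in different components share no edge.
  𝔼-∏Y-split : ∀ (sel g : Fin k → Bool) → (∀ a b → g a ≡ true → adj a b ≡ true → g b ≡ true) →
    𝔼ᴳ (∏Y sel (allFin k))
      ≡ 𝔼ᴳ (∏Y (λ j → sel j ∧ not (g j)) (allFin k)) ℚ.* 𝔼ᴳ (∏Y (λ j → sel j ∧ g j) (allFin k))
  𝔼-∏Y-split sel g g-closed =
    trans (𝔼ᴸ-cong (allEdges n) _ _ (∏Y-split sel g (allFin k)))
          (𝔼ᴸ-*-independent (allEdges n) _ _ _ _ (∏Y-dependsOn _) (∏Y-dependsOn _) apart)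
    where
    apart : ∀ x → edgesOf (λ j → sel j ∧ not (g j)) x ≡ true →
                  edgesOf (λ j → sel j ∧ g j) x ≡ true → ⊥
    apart x outside inside with any-sound _ (allFin k) outside | any-sound _ (allFin k) inside
    ... | b , _ , hb | a , _ , ha =
      true≢false (trans (sym (g-closed a b (Boolₚ.∧-conicalʳ (sel a) _ (Boolₚ.∧-conicalˡ _ _ ha)) a~b))
                        (not-true (Boolₚ.∧-conicalʳ (sel b) _ (Boolₚ.∧-conicalˡ _ _ hb))))
      where
      a~b : adj a b ≡ true
      a~b = any-complete _ (edges (𝐢 a)) x (∈ᵇ-sound x _ (Boolₚ.∧-conicalʳ _ _ ha)) (Boolₚ.∧-conicalʳ _ _ hb)

  Closed : (Fin k → Bool) → Set
  Closed sel = ∀ a b → sel a ≡ true → conn a b ≡ true → sel b ≡ true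

  component : Fin k → List (Fin k)
  component t = filter (λ m → T? (conn t m)) (allFin k)

  component-unique : ∀ t → Unique (component t)
  component-unique t = filter⁺ _ (allFin⁺ k)

  ∈-component : ∀ t m → m ∈ component t → conn t m ≡ true
  ∈-component t m m∈ = T⇒≡true (proj₂ (∈-filter⁻ (λ m → T? (conn t m)) {xs = allFin k} m∈))

  selected-component : ∀ (sel : Fin k → Bool) t → Closed sel → sel t ≡ true →
                       ∀ j → sel j ∧ conn t j ≡ conn t j
  selected-component sel t sel-closed selt j with conn t j in t~j
  ... | true  rewrite sel-closed t j selt t~j = refl
  ... | false = Boolₚ.∧-zeroʳ (sel j)

  𝔼-∏Y-split-component : ∀ (sel : Fin k → Bool) t → Closed sel → sel t ≡ true →
    𝔼ᴳ (∏Y sel (allFin k))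
      ≡ 𝔼ᴳ (∏Y (λ j → sel j ∧ not (conn t j)) (allFin k))
        ℚ.* 𝔼ᴳ (λ σ → foldr (λ j acc → Y′ j σ ℚ.* acc) 1ℚ (component t))
  𝔼-∏Y-split-component sel t sel-closed selt =
    trans (𝔼-∏Y-split sel (conn t) (λ a b t~a a~b → conn-trans t a b t~a (adj⇒conn a b a~b)))
          (cong (𝔼ᴳ (∏Y (λ j → sel j ∧ not (conn t j)) (allFin k)) ℚ.*_) (𝔼ᴸ-cong (allEdges n) _ _ (λ σ →
            trans (∏Y-cong _ (conn t) (selected-component sel t sel-closed selt) (allFin k) σ)
                  (∏Y-filter (conn t) (allFin k) σ))))

  count-outside-component : ∀ (sel : Fin k → Bool) t → Closed sel → sel t ≡ true →
    count (λ j → sel j ∧ not (conn t j)) (allFin k) + ñ t ≡ count sel (allFin k)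
  count-outside-component sel t sel-closed selt =
    trans (cong (count (λ j → sel j ∧ not (conn t j)) (allFin k) +_)
                (trans (ñ≡count t)
                       (count-cong _ _ (allFin k) (λ j _ → sym (selected-component sel t sel-closed selt j)))))
          (sym (count-split sel (conn t) (allFin k)))

  outside-closed : ∀ (sel : Fin k → Bool) t → Closed sel → Closed (λ j → sel j ∧ not (conn t j))
  outside-closed sel t sel-closed a b h a~b with conn t b in t~b
  ... | false = ∧-true (sel-closed a b (Boolₚ.∧-conicalˡ _ _ h) a~b) refl
  ... | true  = ⊥-elim (true≢false (trans (sym (conn-trans t b a t~b (conn-sym a b a~b)))
                                           (not-true (Boolₚ.∧-conicalʳ (sel a) _ h))))

  ∏ : List (Fin k) → Graph → ℚ
  ∏ L σ = foldr (λ j acc → Y′ j σ ℚ.* acc) 1ℚ L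

  module _ (D : ℚ) (pair-value : ∀ a b → a ≢ b → conn a b ≡ true → ñ a ≡ 2 →
                                 𝔼ᴳ (λ σ → Y′ a σ ℚ.* Y′ b σ) ≡ D) where

    𝔼-pair-component : ∀ t → ñ t ≡ 2 → 𝔼ᴳ (∏ (component t)) ≡ D
    𝔼-pair-component t ñt≡2 with unique-length-2 (component t) (component-unique t) ñt≡2
    ... | a , b , a≢b , comp≡ =
      trans (𝔼ᴸ-cong (allEdges n) _ _ (λ σ →
               trans (cong (λ L → ∏ L σ) comp≡) (cong (Y′ a σ ℚ.*_) (ℚₚ.*-identityʳ _))))
            (pair-value a b a≢b (conn-trans a t b (conn-sym t a t~a) t~b) (trans (sym (ñ-cong t a t~a)) ñt≡2))
      where
      t~a : conn t a ≡ true
      t~a = ∈-component t a (subst (a ∈_) (sym comp≡) (here refl))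
      t~b : conn t b ≡ true
      t~b = ∈-component t b (subst (b ∈_) (sym comp≡) (there (here refl)))

    𝔼-∏Y-pairs : ∀ q (sel : Fin k → Bool) → Closed sel → (∀ a → sel a ≡ true → ñ a ≡ 2) →
                 count sel (allFin k) ≡ 2 * q → 𝔼ᴳ (∏Y sel (allFin k)) ≡ D ^ℚ q
    𝔼-∏Y-pairs zero sel _ _ #sel≡0 =
      trans (𝔼ᴸ-cong (allEdges n) _ _ (λ σ →
               ∏Y-empty sel (allFin k) σ (count≡0⇒false sel (allFin k) #sel≡0)))
            (𝔼ᴸ-const (allEdges n) 1ℚ)
    𝔼-∏Y-pairs (suc q) sel sel-closed pairs #sel≡2q+2
      with count-pos⇒witness sel (allFin k) (subst (0 ℕ.<_) (sym #sel≡2q+2) (s≤s z≤n))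
    ... | t , _ , selt =
      begin
        𝔼ᴳ (∏Y sel (allFin k))
      ≡⟨ 𝔼-∏Y-split-component sel t sel-closed selt ⟩
        𝔼ᴳ (∏Y rest (allFin k)) ℚ.* 𝔼ᴳ (∏ (component t))
      ≡⟨ cong₂ ℚ._*_ (𝔼-∏Y-pairs q rest (outside-closed sel t sel-closed)
                                  (λ a h → pairs a (Boolₚ.∧-conicalˡ _ _ h)) #rest≡2q)
                     (𝔼-pair-component t (pairs t selt)) ⟩
        (D ^ℚ q) ℚ.* D
      ≡⟨ ℚₚ.*-comm (D ^ℚ q) D ⟩
        D ^ℚ suc q
      ∎
      where
      open ≡-Reasoning
      rest : Fin k → Bool
      rest j = sel j ∧ not (conn t j)
      #rest≡2q : count rest (allFin k) ≡ 2 * q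
      #rest≡2q = ℕₚ.+-cancelʳ-≡ 2 _ (2 * q)
        (trans (cong (count rest (allFin k) +_) (sym (pairs t selt)))
          (trans (count-outside-component sel t sel-closed selt)
            (trans #sel≡2q+2 (trans (ℕₚ.*-suc 2 q) (ℕₚ.+-comm 2 (2 * q))))))

    TripleFactorisation : ℕ → Set
    TripleFactorisation m =
      Σ (Fin k) λ a → Σ (Fin k) λ b → Σ (Fin k) λ c →
        (a ≢ b × a ≢ c × b ≢ c × conn a b ≡ true × conn a c ≡ true × ñ a ≡ 3) ×
        𝔼ᴳ (∏Y (λ _ → true) (allFin k))
          ≡ (D ^ℚ (m ∸ 1)) ℚ.* 𝔼ᴳ (λ σ → Y′ a σ ℚ.* (Y′ b σ ℚ.* Y′ c σ))

    𝔼-∏Y-one-triple : ∀ m t → k ≡ 2 * m + 1 → ñ t ≡ 3 → (∀ j → conn t j ≡ false → ñ j ≡ 2) →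
                      TripleFactorisation m
    𝔼-∏Y-one-triple m t k≡2m+1 ñt≡3 pairs
      with unique-length-3 (component t) (component-unique t) ñt≡3
    ... | a , b , c , a≢b , a≢c , b≢c , comp≡ =
      a , b , c , (a≢b , a≢c , b≢c , conn-trans a t b a~t t~b , conn-trans a t c a~t t~c ,
                   trans (sym (ñ-cong t a t~a)) ñt≡3) ,
      (begin
        𝔼ᴳ (∏Y (λ _ → true) (allFin k))
      ≡⟨ 𝔼-∏Y-split-component (λ _ → true) t (λ _ _ _ _ → refl) refl ⟩
        𝔼ᴳ (∏Y rest (allFin k)) ℚ.* 𝔼ᴳ (∏ (component t))
      ≡⟨ cong₂ ℚ._*_ (𝔼-∏Y-pairs (m ∸ 1) rest (outside-closed (λ _ → true) t (λ _ _ _ _ → refl))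
                                  (λ j h → pairs j (not-true h)) #rest≡2[m-1])
                     (𝔼ᴸ-cong (allEdges n) _ _ (λ σ → trans (cong (λ L → ∏ L σ) comp≡)
                                                            (cong (λ x → Y′ a σ ℚ.* (Y′ b σ ℚ.* x)) (ℚₚ.*-identityʳ _)))) ⟩
        (D ^ℚ (m ∸ 1)) ℚ.* 𝔼ᴳ (λ σ → Y′ a σ ℚ.* (Y′ b σ ℚ.* Y′ c σ))
      ∎)
      where
      open ≡-Reasoning
      rest : Fin k → Bool
      rest j = not (conn t j)
      t~a : conn t a ≡ true
      t~a = ∈-component t a (subst (a ∈_) (sym comp≡) (here refl))
      a~t : conn a t ≡ true
      a~t = conn-sym t a t~a
      t~b : conn t b ≡ true
      t~b = ∈-component t b (subst (b ∈_) (sym comp≡) (there (here refl)))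
      t~c : conn t c ≡ true
      t~c = ∈-component t c (subst (c ∈_) (sym comp≡) (there (there (here refl))))
      #rest≡2[m-1] : count rest (allFin k) ≡ 2 * (m ∸ 1)
      #rest≡2[m-1] = x+3≡2m+1⇒x≡2[m∸1] m _
        (trans (cong (count rest (allFin k) +_) (sym ñt≡3))
          (trans (count-outside-component (λ _ → true) t (λ _ _ _ _ → refl) refl)
                 (trans (count-allFin-true k) k≡2m+1)))

^ℚ-+ : ∀ x a b → x ^ℚ (a + b) ≡ (x ^ℚ a) ℚ.* (x ^ℚ b)
^ℚ-+ x zero    b = sym (ℚₚ.*-identityˡ _)
^ℚ-+ x (suc a) b rewrite ^ℚ-+ x a b = sym (ℚₚ.*-assoc x _ _)

kissing-value : ∀ p ℓ → 1 ≤ ℓ →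
                p ^ℚ ((ℓ ∸ 1) + ℓ) - p ^ℚ ℓ ℚ.* p ^ℚ ℓ ≡ p ^ℚ (2 * ℓ ∸ 1) - p ^ℚ (2 * ℓ)
kissing-value p (suc l) _ =
  cong₂ _-_ (cong (λ e → p ^ℚ (l + e)) (sym (ℕₚ.+-identityʳ (suc l))))
            (sym (trans (cong (λ e → p ^ℚ (suc l + e)) (ℕₚ.+-identityʳ (suc l))) (^ℚ-+ p (suc l) (suc l))))

module TripleValues (p : ℚ) (l : ℕ) where

  -- The right-hand side of triple-moment for ℓ = suc l when the triple covers 3ℓ - 2 edges.
  triple : ℕ → ℕ → ℕ → ℚ
  triple d₁₂ d₁₃ d₂₃ =
    p ^ℚ (l + (l + suc l)) - c ℚ.* (p ^ℚ d₁₂ ℚ.+ p ^ℚ d₁₃ ℚ.+ p ^ℚ d₂₃) ℚ.+ (c ℚ.* (c ℚ.* c) ℚ.+ c ℚ.* (c ℚ.* c))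
    where
    c : ℚ
    c = p ^ℚ suc l

  3ℓ∸2 : p ^ℚ (3 * suc l ∸ 2) ≡ p ^ℚ (l + (l + suc l))
  3ℓ∸2 = cong (p ^ℚ_) (trans (cong (_∸ 2) 3[1+l]≡2+[l+[l+[1+l]]]) (ℕₚ.m+n∸m≡n 2 (l + (l + suc l))))
    where
    open ℕ-Solver.+-*-Solver
    3[1+l]≡2+[l+[l+[1+l]]] : 3 * suc l ≡ 2 + (l + (l + suc l))
    3[1+l]≡2+[l+[l+[1+l]]] = solve 1 (λ l → con 3 :* (con 1 :+ l) := con 2 :+ (l :+ (l :+ (con 1 :+ l)))) refl l

  -- After the rewrites every power is a monomial in p and r = p ^ℚ l.
  chained-value : triple (l + suc l) (suc l + suc l) (l + suc l)
                  ≡ p ^ℚ (l + (l + suc l)) ℚ.* ((1ℚ - p) ℚ.* (1ℚ - p))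
  chained-value rewrite ^ℚ-+ p l (l + suc l) | ^ℚ-+ p l (suc l) =
    solve 2 (λ p r → r :* (r :* (p :* r)) :- (p :* r) :* (r :* (p :* r) :+ p :* (r :* (p :* r)) :+ r :* (p :* r))
                     :+ ((p :* r) :* ((p :* r) :* (p :* r)) :+ (p :* r) :* ((p :* r) :* (p :* r)))
                  := (r :* (r :* (p :* r))) :* ((con 1ℚ :- p) :* (con 1ℚ :- p))) refl p (p ^ℚ l)
    where open +-*-Solver

  flower-value : triple (l + suc l) (l + suc l) (l + suc l)
                 ≡ p ^ℚ (l + (l + suc l)) ℚ.* ((1ℚ - p) ℚ.* (1ℚ - (p ℚ.+ p)))
  flower-value rewrite ^ℚ-+ p l (l + suc l) | ^ℚ-+ p l (suc l) =
    solve 2 (λ p r → r :* (r :* (p :* r)) :- (p :* r) :* (r :* (p :* r) :+ r :* (p :* r) :+ r :* (p :* r))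
                     :+ ((p :* r) :* ((p :* r) :* (p :* r)) :+ (p :* r) :* ((p :* r) :* (p :* r)))
                  := (r :* (r :* (p :* r))) :* ((con 1ℚ :- p) :* (con 1ℚ :- (p :+ p)))) refl p (p ^ℚ l)
    where open +-*-Solver

*-nonNeg : ∀ {a b} → 0ℚ ℚ.≤ a → 0ℚ ℚ.≤ b → 0ℚ ℚ.≤ a ℚ.* b
*-nonNeg {a} {b} 0≤a 0≤b =
  ℚₚ.nonNegative⁻¹ (a ℚ.* b) {{ℚₚ.nonNeg*nonNeg⇒nonNeg a {{ℚ.nonNegative 0≤a}} b {{ℚ.nonNegative 0≤b}}}}

^ℚ-nonNeg : ∀ {x} j → 0ℚ ℚ.≤ x → 0ℚ ℚ.≤ x ^ℚ j
^ℚ-nonNeg zero    _   = ℚₚ.<⇒≤ (ℚₚ.positive⁻¹ 1ℚ)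
^ℚ-nonNeg (suc j) 0≤x = *-nonNeg 0≤x (^ℚ-nonNeg j 0≤x)

*-≤1 : ∀ {a b} → 0ℚ ℚ.≤ a → a ℚ.≤ 1ℚ → b ℚ.≤ 1ℚ → 0ℚ ℚ.≤ b → a ℚ.* b ℚ.≤ 1ℚ
*-≤1 {a} {b} 0≤a a≤1 b≤1 0≤b =
  ℚₚ.≤-trans (ℚₚ.*-monoʳ-≤-nonNeg b {{ℚ.nonNegative 0≤b}} a≤1)
             (ℚₚ.≤-trans (ℚₚ.≤-reflexive (ℚₚ.*-identityˡ b)) b≤1)

∣a*[w*x]∣≤a*w : ∀ {a w x} → 0ℚ ℚ.≤ a → 0ℚ ℚ.≤ w → ∣ x ∣ ℚ.≤ 1ℚ → ∣ a ℚ.* (w ℚ.* x) ∣ ℚ.≤ a ℚ.* w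
∣a*[w*x]∣≤a*w {a} {w} {x} 0≤a 0≤w ∣x∣≤1 = begin
  ∣ a ℚ.* (w ℚ.* x) ∣     ≡⟨ ℚₚ.∣p*q∣≡∣p∣*∣q∣ a (w ℚ.* x) ⟩
  ∣ a ∣ ℚ.* ∣ w ℚ.* x ∣   ≡⟨ cong₂ ℚ._*_ (ℚₚ.0≤p⇒∣p∣≡p 0≤a) (ℚₚ.∣p*q∣≡∣p∣*∣q∣ w x) ⟩
  a ℚ.* (∣ w ∣ ℚ.* ∣ x ∣) ≡⟨ cong (λ y → a ℚ.* (y ℚ.* ∣ x ∣)) (ℚₚ.0≤p⇒∣p∣≡p 0≤w) ⟩
  a ℚ.* (w ℚ.* ∣ x ∣)     ≤⟨ ℚₚ.*-monoˡ-≤-nonNeg a {{ℚ.nonNegative 0≤a}}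
                               (ℚₚ.*-monoˡ-≤-nonNeg w {{ℚ.nonNegative 0≤w}} ∣x∣≤1) ⟩
  a ℚ.* (w ℚ.* 1ℚ)        ≡⟨ cong (a ℚ.*_) (ℚₚ.*-identityʳ w) ⟩
  a ℚ.* w                 ∎
  where open ℚₚ.≤-Reasoning

module _ {p : ℚ} (0≤p : 0ℚ ℚ.≤ p) (p≤1 : p ℚ.≤ 1ℚ) where
  open +-*-Solver

  0≤1-p : 0ℚ ℚ.≤ 1ℚ - p
  0≤1-p = ℚₚ.≤-trans (ℚₚ.≤-reflexive (sym (ℚₚ.+-inverseʳ p))) (ℚₚ.+-monoˡ-≤ (- p) p≤1)

  1-p≤1 : 1ℚ - p ℚ.≤ 1ℚ
  1-p≤1 = ℚₚ.≤-trans (ℚₚ.+-monoʳ-≤ 1ℚ (ℚₚ.neg-antimono-≤ 0≤p)) (ℚₚ.≤-reflexive (ℚₚ.+-identityʳ 1ℚ))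

  ∣1-2p∣≤1 : ∣ 1ℚ - (p ℚ.+ p) ∣ ℚ.≤ 1ℚ
  ∣1-2p∣≤1 with ℚₚ.∣p∣≡p∨∣p∣≡-p (1ℚ - (p ℚ.+ p))
  ... | inj₁ ∣x∣≡x = ℚₚ.≤-trans (ℚₚ.≤-reflexive ∣x∣≡x)
    (ℚₚ.≤-trans (ℚₚ.+-monoʳ-≤ 1ℚ (ℚₚ.neg-antimono-≤ (ℚₚ.+-mono-≤ 0≤p 0≤p)))
                (ℚₚ.≤-reflexive (ℚₚ.+-identityʳ 1ℚ)))
  ... | inj₂ ∣x∣≡-x = ℚₚ.≤-trans (ℚₚ.≤-reflexive ∣x∣≡-x)
    (ℚₚ.≤-trans (ℚₚ.≤-reflexive (solve 1 (λ p → :- (con 1ℚ :- (p :+ p)) := (p :+ p) :- con 1ℚ) refl p))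
                (ℚₚ.+-monoˡ-≤ (- 1ℚ) (ℚₚ.+-mono-≤ p≤1 p≤1)))

  ∣[1-p][1-p]∣≤1 : ∣ (1ℚ - p) ℚ.* (1ℚ - p) ∣ ℚ.≤ 1ℚ
  ∣[1-p][1-p]∣≤1 =
    ℚₚ.≤-trans (ℚₚ.≤-reflexive (ℚₚ.0≤p⇒∣p∣≡p (*-nonNeg 0≤1-p 0≤1-p))) (*-≤1 0≤1-p 1-p≤1 1-p≤1 0≤1-p)

  ∣[1-p][1-2p]∣≤1 : ∣ (1ℚ - p) ℚ.* (1ℚ - (p ℚ.+ p)) ∣ ℚ.≤ 1ℚ
  ∣[1-p][1-2p]∣≤1 =
    ℚₚ.≤-trans (ℚₚ.≤-reflexive (trans (ℚₚ.∣p*q∣≡∣p∣*∣q∣ (1ℚ - p) (1ℚ - (p ℚ.+ p)))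
                                      (cong (ℚ._* ∣ 1ℚ - (p ℚ.+ p) ∣) (ℚₚ.0≤p⇒∣p∣≡p 0≤1-p))))
               (*-≤1 0≤1-p 1-p≤1 ∣1-2p∣≤1 (ℚₚ.0≤∣p∣ (1ℚ - (p ℚ.+ p))))

-- Kissing pairs, chained triples and flowers

module Configurations (n l : ℕ) (p : ℚ) where
  open RandomGraph n p
  open TripleValues p l
  open +-*-Solver

  kissing-moment : (M M′ : Matching n (suc l)) → Kissing M M′ →
    𝔼ᴳ (λ σ → Yᵍ M σ ℚ.* Yᵍ M′ σ) ≡ p ^ℚ (2 * suc l ∸ 1) - p ^ℚ (2 * suc l)
  kissing-moment M M′ (_ , |M∩M′|≡1) =
    trans (pair-moment M M′)
          (trans (cong (λ d → p ^ℚ d - p ^ℚ suc l ℚ.* p ^ℚ suc l)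
                       (trans (#distinct-pair M M′) (cong (λ i → (suc l ∸ i) + suc l) |M∩M′|≡1)))
                 (kissing-value p (suc l) (s≤s z≤n)))

  Y³ : Matching n (suc l) → Matching n (suc l) → Matching n (suc l) → Graph → ℚ
  Y³ M₁ M₂ M₃ σ = Yᵍ M₁ σ ℚ.* (Yᵍ M₂ σ ℚ.* Yᵍ M₃ σ)

  chained-moment : (M₁ M₂ M₃ : Matching n (suc l)) → Chained M₁ M₂ M₃ →
    𝔼ᴳ (Y³ M₁ M₂ M₃) ≡ p ^ℚ (3 * suc l ∸ 2) ℚ.* ((1ℚ - p) ℚ.* (1ℚ - p))
  chained-moment M₁ M₂ M₃ (|M₁∩M₂|≡1 , |M₂∩M₃|≡1 , |M₁∩M₃|≡0)
    rewrite triple-moment M₁ M₂ M₃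
          | #distinct-triple M₁ M₂ M₃ | #shared-chained M₁ M₂ M₃ |M₁∩M₂|≡1 |M₁∩M₃|≡0
          | #distinct-pair M₁ M₂ | #distinct-pair M₁ M₃ | #distinct-pair M₂ M₃
          | |M₁∩M₂|≡1 | |M₂∩M₃|≡1 | |M₁∩M₃|≡0 | 3ℓ∸2 = chained-value

  flower-moment : (M₁ M₂ M₃ : Matching n (suc l)) → Flower3 M₁ M₂ M₃ →
    𝔼ᴳ (Y³ M₁ M₂ M₃) ≡ p ^ℚ (3 * suc l ∸ 2) ℚ.* ((1ℚ - p) ℚ.* (1ℚ - (p ℚ.+ p)))
  flower-moment M₁ M₂ M₃ (_ , _ , _ , e , e∈M₁ , e∈M₂ , e∈M₃ , |M₁∩M₂|≡1 , |M₁∩M₃|≡1 , |M₂∩M₃|≡1)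
    rewrite triple-moment M₁ M₂ M₃
          | #distinct-triple M₁ M₂ M₃ | #shared-flower M₁ M₂ M₃ e e∈M₁ e∈M₂ e∈M₃ |M₁∩M₂|≡1 |M₁∩M₃|≡1
          | #distinct-pair M₁ M₂ | #distinct-pair M₁ M₃ | #distinct-pair M₂ M₃
          | |M₁∩M₂|≡1 | |M₁∩M₃|≡1 | |M₂∩M₃|≡1 | 3ℓ∸2 = flower-value

  Y³-swap₁₂ : ∀ M₁ M₂ M₃ → 𝔼ᴳ (Y³ M₁ M₂ M₃) ≡ 𝔼ᴳ (Y³ M₂ M₁ M₃)
  Y³-swap₁₂ M₁ M₂ M₃ = 𝔼ᴸ-cong (allEdges n) _ _ (λ σ →
    solve 3 (λ x y z → x :* (y :* z) := y :* (x :* z)) refl (Yᵍ M₁ σ) (Yᵍ M₂ σ) (Yᵍ M₃ σ))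

  Y³-swap₂₃ : ∀ M₁ M₂ M₃ → 𝔼ᴳ (Y³ M₁ M₂ M₃) ≡ 𝔼ᴳ (Y³ M₁ M₃ M₂)
  Y³-swap₂₃ M₁ M₂ M₃ =
    𝔼ᴸ-cong (allEdges n) _ _ (λ σ → cong (Yᵍ M₁ σ ℚ.*_) (ℚₚ.*-comm (Yᵍ M₂ σ) (Yᵍ M₃ σ)))

  TripleBounded : Matching n (suc l) → Matching n (suc l) → Matching n (suc l) → Set
  TripleBounded M₁ M₂ M₃ = Σ ℚ λ x → 𝔼ᴳ (Y³ M₁ M₂ M₃) ≡ p ^ℚ (3 * suc l ∸ 2) ℚ.* x × ∣ x ∣ ℚ.≤ 1ℚ

  triple-bounded : 0ℚ ℚ.≤ p → p ℚ.≤ 1ℚ → ∀ M₁ M₂ M₃ →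
    ChainedSomeOrder M₁ M₂ M₃ ⊎ Flower3 M₁ M₂ M₃ → TripleBounded M₁ M₂ M₃
  triple-bounded 0≤p p≤1 M₁ M₂ M₃ (inj₂ flower) =
    _ , flower-moment M₁ M₂ M₃ flower , ∣[1-p][1-2p]∣≤1 0≤p p≤1
  triple-bounded 0≤p p≤1 M₁ M₂ M₃ (inj₁ chained) = reorder chained
    where
    via : ∀ A B C → 𝔼ᴳ (Y³ M₁ M₂ M₃) ≡ 𝔼ᴳ (Y³ A B C) →
          Chained A B C → TripleBounded M₁ M₂ M₃
    via A B C same ch = _ , trans same (chained-moment A B C ch) , ∣[1-p][1-p]∣≤1 0≤p p≤1
    reorder : ChainedSomeOrder M₁ M₂ M₃ → TripleBounded M₁ M₂ M₃
    reorder (inj₁ ch) = via M₁ M₂ M₃ refl ch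
    reorder (inj₂ (inj₁ ch)) = via M₁ M₃ M₂ (Y³-swap₂₃ M₁ M₂ M₃) ch
    reorder (inj₂ (inj₂ (inj₁ ch))) = via M₂ M₁ M₃ (Y³-swap₁₂ M₁ M₂ M₃) ch
    reorder (inj₂ (inj₂ (inj₂ (inj₁ ch)))) =
      via M₂ M₃ M₁ (trans (Y³-swap₁₂ M₁ M₂ M₃) (Y³-swap₂₃ M₂ M₁ M₃)) ch
    reorder (inj₂ (inj₂ (inj₂ (inj₂ (inj₁ ch))))) =
      via M₃ M₁ M₂ (trans (Y³-swap₂₃ M₁ M₂ M₃) (Y³-swap₁₂ M₁ M₃ M₂)) ch
    reorder (inj₂ (inj₂ (inj₂ (inj₂ (inj₂ ch))))) =
      via M₃ M₂ M₁ (trans (Y³-swap₁₂ M₁ M₂ M₃) (trans (Y³-swap₂₃ M₂ M₁ M₃) (Y³-swap₁₂ M₂ M₃ M₁))) ch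

module MomentOf {n l k : ℕ} {p : ℚ} (0<p : 0ℚ < p) (p<1 : p < 1ℚ)
                (𝐢 : Fin k → Matching n (suc l)) (𝐢∈𝒦′ : InK' 𝐢) where
  open RandomGraph n p
  open Tuple 𝐢
  open Components 𝐢
  open ComponentCount 𝐢
  open Factorisation p 𝐢
  open Configurations n l p

  ñ≥2 : InK 𝐢
  ñ≥2 = proj₁ 𝐢∈𝒦′

  #components≡⌊k/2⌋ : numComponents ≡ ⌊ k /2⌋
  #components≡⌊k/2⌋ = proj₁ (proj₂ 𝐢∈𝒦′)

  D W : ℚ
  D = p ^ℚ (2 * suc l ∸ 1) - p ^ℚ (2 * suc l)
  W = p ^ℚ (3 * suc l ∸ 2)

  0≤p : 0ℚ ℚ.≤ p
  0≤p = ℚₚ.<⇒≤ 0<p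

  0≤D : 0ℚ ℚ.≤ D
  0≤D = subst (0ℚ ℚ.≤_) (sym D≡p^[2ℓ-1][1-p])
              (*-nonNeg (^ℚ-nonNeg (l + suc l) 0≤p) (0≤1-p 0≤p (ℚₚ.<⇒≤ p<1)))
    where
    open +-*-Solver
    D≡p^[2ℓ-1][1-p] : D ≡ p ^ℚ (l + suc l) ℚ.* (1ℚ - p)
    D≡p^[2ℓ-1][1-p] rewrite ℕₚ.+-identityʳ (suc l) =
      solve 2 (λ p P → P :- p :* P := P :* (con 1ℚ :- p)) refl p (p ^ℚ (l + suc l))

  pair-value : ∀ a b → a ≢ b → conn a b ≡ true → ñ a ≡ 2 →
               𝔼ᴳ (λ σ → Y′ a σ ℚ.* Y′ b σ) ≡ D
  pair-value a b a≢b a~b ña≡2 = kissing-moment (𝐢 a) (𝐢 b) (proj₁ (proj₂ (proj₂ 𝐢∈𝒦′)) a b a≢b a~b ña≡2)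

  𝔼∏Y≡𝔼ᴳ : 𝔼 n p (prodY p 𝐢) ≡ 𝔼ᴳ (∏Y (λ _ → true) (allFin k))
  𝔼∏Y≡𝔼ᴳ = 𝔼≡𝔼ᴳ (∏Y (λ _ → true) (allFin k))

  even-moment : ∀ m → k ≡ 2 * m → 𝔼 n p (prodY p 𝐢) ≡ D ^ℚ m
  even-moment m k≡2m =
    trans 𝔼∏Y≡𝔼ᴳ (𝔼-∏Y-pairs D pair-value m (λ _ → true) (λ _ _ _ _ → refl)
                   (λ a _ → even-components ñ≥2 #components≡⌊k/2⌋ m k≡2m a)
                   (trans (count-allFin-true k) k≡2m))

  odd-moment-bound : ∀ m → k ≡ 2 * m + 1 → ∣ 𝔼 n p (prodY p 𝐢) ∣ ℚ.≤ (D ^ℚ (m ∸ 1)) ℚ.* W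
  odd-moment-bound m k≡2m+1 =
    from-component (odd-components ñ≥2 #components≡⌊k/2⌋ m k≡2m+1)
    where
    -- Helper functions rather than with-abstraction: abstracting this goal exhausts memory.
    bound : ∀ {a b c} →
            𝔼ᴳ (∏Y (λ _ → true) (allFin k)) ≡ (D ^ℚ (m ∸ 1)) ℚ.* 𝔼ᴳ (Y³ (𝐢 a) (𝐢 b) (𝐢 c)) →
            TripleBounded (𝐢 a) (𝐢 b) (𝐢 c) → ∣ 𝔼 n p (prodY p 𝐢) ∣ ℚ.≤ (D ^ℚ (m ∸ 1)) ℚ.* W
    bound factorised (x , triple≡Wx , ∣x∣≤1) =
      subst (λ e → ∣ e ∣ ℚ.≤ (D ^ℚ (m ∸ 1)) ℚ.* W)
            (sym (trans 𝔼∏Y≡𝔼ᴳ (trans factorised (cong (D ^ℚ (m ∸ 1) ℚ.*_) triple≡Wx))))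
            (∣a*[w*x]∣≤a*w (^ℚ-nonNeg (m ∸ 1) 0≤D) (^ℚ-nonNeg (3 * suc l ∸ 2) 0≤p) ∣x∣≤1)
    from-triple : TripleFactorisation D pair-value m → ∣ 𝔼 n p (prodY p 𝐢) ∣ ℚ.≤ (D ^ℚ (m ∸ 1)) ℚ.* W
    from-triple (a , b , c , (a≢b , a≢c , b≢c , a~b , a~c , ña≡3) , factorised) =
      bound factorised (triple-bounded 0≤p (ℚₚ.<⇒≤ p<1) (𝐢 a) (𝐢 b) (𝐢 c)
                         (proj₂ (proj₂ (proj₂ 𝐢∈𝒦′)) a b c a≢b a≢c b≢c a~b a~c ña≡3))
    from-component : (Σ (Fin k) λ t → ñ t ≡ 3 × (∀ j → conn t j ≡ false → ñ j ≡ 2)) →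
                     ∣ 𝔼 n p (prodY p 𝐢) ∣ ℚ.≤ (D ^ℚ (m ∸ 1)) ℚ.* W
    from-component (t , ñt≡3 , pairs) = from-triple (𝔼-∏Y-one-triple D pair-value m t k≡2m+1 ñt≡3 pairs)

proposition8 : (n ℓ k : ℕ) → 1 ≤ n → 1 ≤ ℓ → 1 ≤ k →
    (p : ℚ) → 0ℚ < p → p < 1ℚ →
    (𝐢 : Fin k → Matching n ℓ) → InK' 𝐢 →
      ((m : ℕ) → k ≡ 2 * m →
         𝔼 n p (prodY p 𝐢) ≡ ((p ^ℚ (2 * ℓ ∸ 1)) - (p ^ℚ (2 * ℓ))) ^ℚ m)
      × ((m : ℕ) → k ≡ 2 * m + 1 →
         Data.Rational._≤_ ∣ 𝔼 n p (prodY p 𝐢) ∣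
           ((((p ^ℚ (2 * ℓ ∸ 1)) - (p ^ℚ (2 * ℓ))) ^ℚ (m ∸ 1)) Data.Rational.* (p ^ℚ (3 * ℓ ∸ 2))))
proposition8 n zero    k _ () _ p _ _ 𝐢 _
proposition8 n (suc l) k _ _  _ p 0<p p<1 𝐢 𝐢∈𝒦′ = even-moment , odd-moment-bound
  where open MomentOf 0<p p<1 𝐢 𝐢∈𝒦′
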